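{- Let $p\ge4$, $k\ge p$, $j\in\{1,\dots,p\}$. Let $x\in\{0,1\}^N$ be a content of registers $1,\dots,N$ such that for every $t=1,\dots,b$ the column $C_t=\{t+lb:0\le l\le n-1\}$, read in increasing register order, is of the form $0^*1^*$. Let $c_t$ be the number of ones of $x$ in $C_t$, $\bar c=(c_1,\dots,c_b)$, let $y=T_j(x)$ be the result of applying stage $T_j$ to $x$, and let $d_t$ be the number of ones of $y$ in $C_t$. Then $Q_j(\bar c)=(d_1,\dots,d_b)$.
   Context: Comparator $[u:v]$, $u<v$: puts min of contents of $u,v$ into $u$ and max into $v$; a stage applies comparators on disjoint pairs simultaneously. Let $n=2^{k-1}-1$, $b=2\lceil\frac{k-2}{p-2}\rceil$, $N=nb$, $D=k-1+\frac b2$. Define $S_1=\{[bi:bi+1]:1\le i\le n-1\}$; for $1\le j\le b/2$ and integer $s$ with $(p-2)(j-1)<s\le\min((p-2)j,k-1)$: $S_{j+s}=\{[bi+j: b(i+2^{k-s-1}-1)+b-j+1]:0\le i\le n-2^{k-s-1}\}$; for integer $j$ with $1\le j\le\frac{k-2}{p-2}$: $S_{(p-1)j+1}=\{[bi+j:bi+j+1],[bi+b-j:bi+b-j+1]:0\le i\le n-1\}$. For $x=1,\dots,p$, $T_x=\bigcup\{S_{x+pi}:i\ge0,\ x+pi\le D\}$. Let $h_s=2^{k-s-1}-1$. Maps $\mathbb R^b\to\mathbb R^b$ (unmentioned coordinates unchanged): $cyc$: coordinate 1 becomes $\max(c_1,c_b-1)$, coordinate $b$ becomes $\min(c_1+1,c_b)$;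 $dec_{j,s}$ ($1\le j\le b/2$, $1\le s\le k-1$): coordinate $j$ becomes $\min(c_j,c_{b-j+1}+h_s)$, coordinate $b-j+1$ becomes $\max(c_j-h_s,c_{b-j+1})$; $mov_j$ ($1\le j\le b/2$): for $t\in\{j,b-j\}$ coordinate $t$ becomes $\min(c_t,c_{t+1})$, for $t\in\{j+1,b-j+1\}$ coordinate $t$ becomes $\max(c_{t-1},c_t)$. For $x=1,\dots,p$: $MV_x=\{mov_j:1\le j\le\frac{k-2}{p-2},\ x+j\equiv1\pmod p\}$, $DC_x=\{dec_{j,s}:1\le j\le b/2,\ (x+j)\bmod p\notin\{1,2\},\ s=(p-2)(j-1)-1+((x+j-1)\bmod p)\le k-1\}$; $Q_1=\{cyc\}\cup MV_1\cup DC_1$, $Q_x=MV_x\cup DC_x$ ($2\le x\le p$). The functions in one $Q_x$ modify pairwise disjoint sets of coordinates, and $Q_x$ also denotes the map obtained by composing all of them (in any order). -}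

module Defs where

open import Data.Bool using (Bool; true; false; if_then_else_; _∧_; _∨_; not)
open import Data.Nat using (ℕ; zero; suc; _+_; _*_; _∸_; _^_; _≡ᵇ_; _≤ᵇ_; _<ᵇ_; _/_; _%_; _<_)
open import Data.Product using (_×_; _,_)
open import Data.List using (List; []; _∷_; _++_; map; concatMap; upTo; foldl; filterᵇ; length)
open import Data.Integer as ℤ using (ℤ)
open import Relation.Binary.PropositionalEquality using (_≡_)

-- ceiling division ⌈a / d⌉ (only used with d > 0)
cdiv : ℕ → ℕ → ℕ
cdiv a zero = 0
cdiv a (suc d) = (a + d) / suc d

modN : ℕ → ℕ → ℕ
modN a zero = a
modN a (suc d) = a % suc d

-- the list [a, a+1, ..., c]  (empty if c < a)
range : ℕ → ℕ → List ℕ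
range a c = map (λ i → a + i) (upTo (suc c ∸ a))

nR : ℕ → ℕ
nR k = 2 ^ (k ∸ 1) ∸ 1

-- b/2 = ⌈(k-2)/(p-2)⌉
hb : ℕ → ℕ → ℕ
hb p k = cdiv (k ∸ 2) (p ∸ 2)

bW : ℕ → ℕ → ℕ
bW p k = 2 * hb p k

NR : ℕ → ℕ → ℕ
NR p k = nR k * bW p k

DS : ℕ → ℕ → ℕ
DS p k = (k ∸ 1) + hb p k

hs : ℕ → ℕ → ℕ
hs k s = 2 ^ (k ∸ s ∸ 1) ∸ 1

Comparator : Set
Comparator = ℕ × ℕ

applyComp : Comparator → (ℕ → Bool) → (ℕ → Bool)
applyComp (u , v) x r =
  if r ≡ᵇ u then x u ∧ x v
  else if r ≡ᵇ v then x u ∨ x v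
  else x r

-- apply the comparators of a stage (pairwise disjoint, so the order is irrelevant)
runStage : List Comparator → (ℕ → Bool) → (ℕ → Bool)
runStage cs x = foldl (λ y c → applyComp c y) x cs

S₁ : ℕ → ℕ → List Comparator
S₁ p k = map (λ i → (bW p k * i , bW p k * i + 1)) (range 1 (nR k ∸ 1))

-- contributions to S_m of the form S_{j+s}, 1 ≤ j ≤ b/2,
-- (p-2)(j-1) < s ≤ min((p-2)j, k-1):
-- {[bi+j : b(i+2^(k-s-1)-1)+b-j+1] : 0 ≤ i ≤ n - 2^(k-s-1)}
Sdec : ℕ → ℕ → ℕ → List Comparator
Sdec p k m = concatMap part (range 1 (hb p k))
  where
  b = bW p k
  part : ℕ → List Comparator
  part j with m ∸ j
  ... | s =
    if (j <ᵇ m) ∧ (((p ∸ 2) * (j ∸ 1)) <ᵇ s) ∧ (s ≤ᵇ (p ∸ 2) * j) ∧ (s ≤ᵇ k ∸ 1)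
    then map (λ i → (b * i + j , b * (i + hs k s) + (b ∸ j) + 1))
             (range 0 (nR k ∸ 2 ^ (k ∸ s ∸ 1)))
    else []

-- contributions to S_m of the form S_{(p-1)j+1}, 1 ≤ j ≤ (k-2)/(p-2):
-- {[bi+j : bi+j+1], [bi+b-j : bi+b-j+1] : 0 ≤ i ≤ n-1}
Smov : ℕ → ℕ → ℕ → List Comparator
Smov p k m = concatMap part (range 1 (k ∸ 2))
  where
  b = bW p k
  part : ℕ → List Comparator
  part j =
    if (j * (p ∸ 2) ≤ᵇ k ∸ 2) ∧ ((p ∸ 1) * j + 1 ≡ᵇ m)
    then concatMap (λ i → (b * i + j , b * i + j + 1)
                          ∷ (b * i + (b ∸ j) , b * i + (b ∸ j) + 1) ∷ [])
                   (range 0 (nR k ∸ 1))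
    else []

S : ℕ → ℕ → ℕ → List Comparator
S p k m = (if m ≡ᵇ 1 then S₁ p k else []) ++ Sdec p k m ++ Smov p k m

Tst : ℕ → ℕ → ℕ → List Comparator
Tst p k x = concatMap (S p k)
  (filterᵇ (λ m → m ≤ᵇ DS p k) (map (λ i → x + p * i) (range 0 (DS p k))))

ColumnSorted : ℕ → ℕ → (ℕ → Bool) → ℕ → Set
ColumnSorted p k x t =
  ∀ l l' → l < l' → l' < nR k →
    x (t + l * bW p k) ≡ true → x (t + l' * bW p k) ≡ true

colOnes : ℕ → ℕ → (ℕ → Bool) → ℕ → ℕ
colOnes p k x t = length (filterᵇ (λ l → x (t + l * bW p k)) (upTo (nR k)))

Vecb : Set
Vecb = ℕ → ℤ

cyc : ℕ → Vecb → Vecb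
cyc b c t =
  if t ≡ᵇ 1 then c 1 ℤ.⊔ (c b ℤ.- ℤ.+ 1)
  else if t ≡ᵇ b then (c 1 ℤ.+ ℤ.+ 1) ℤ.⊓ c b
  else c t

dec : ℕ → ℕ → ℕ → Vecb → Vecb
dec b j h c t =
  if t ≡ᵇ j then c j ℤ.⊓ (c (b ∸ j + 1) ℤ.+ ℤ.+ h)
  else if t ≡ᵇ b ∸ j + 1 then (c j ℤ.- ℤ.+ h) ℤ.⊔ c (b ∸ j + 1)
  else c t

mov : ℕ → ℕ → Vecb → Vecb
mov b j c t =
  if (t ≡ᵇ j) ∨ (t ≡ᵇ b ∸ j) then c t ℤ.⊓ c (suc t)
  else if (t ≡ᵇ j + 1) ∨ (t ≡ᵇ b ∸ j + 1) then c (t ∸ 1) ℤ.⊔ c t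
  else c t

MV : ℕ → ℕ → ℕ → List (Vecb → Vecb)
MV p k x = map (mov (bW p k))
  (filterᵇ (λ j → (j * (p ∸ 2) ≤ᵇ k ∸ 2) ∧ (modN (x + j) p ≡ᵇ modN 1 p))
           (range 1 (k ∸ 2)))

DC : ℕ → ℕ → ℕ → List (Vecb → Vecb)
DC p k x = concatMap part (range 1 (hb p k))
  where
  part : ℕ → List (Vecb → Vecb)
  part j with modN (x + j) p | (p ∸ 2) * (j ∸ 1) + modN (x + j ∸ 1) p ∸ 1
  ... | r | s =
    if not (r ≡ᵇ 1) ∧ not (r ≡ᵇ 2) ∧ (s ≤ᵇ k ∸ 1)
    then dec (bW p k) j (hs k s) ∷ []
    else []

-- Q_x : composition of all maps in Q_x (they act on disjoint coordinates)
Qmap : ℕ → ℕ → ℕ → Vecb → Vecb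
Qmap p k x c = foldl (λ v f → f v) c
  ((if x ≡ᵇ 1 then cyc (bW p k) ∷ [] else []) ++ MV p k x ++ DC p k x)

-- A sorted column C_t is 0^{z_t} 1^{n - z_t}, so it is described by its number z_t of zeros.
-- The comparators of T_j fall into families [b i + A : b (i + h) + B] (i ranging over the rows),
-- one or two for each map cyc, mov_j, dec_{j,s} of Q_j, and different families use different
-- columns: every column t has a key u ≤ b/2 with t ∈ {u, b + 1 - u}, and the arithmetic of
-- residues modulo p shows that different maps of Q_j have different keys. Hence T_j acts on
-- each family separately, and a family with offset h sends the zero counts (z_A, z_B) to
-- (max(z_A, z_B - h), min(z_A + h, z_B)) while keeping both columns sorted. For the numbers of
-- ones c = n - z this is c_A ↦ min(c_A, c_B + h), c_B ↦ max(c_A - h, c_B): the map of Q_j on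
-- the coordinates A and B.

module Submission where

open import Defs
open import Data.Bool using (Bool; true; false; if_then_else_; _∧_; _∨_; not; T)
open import Data.Bool.Properties using (T-≡; T-not-≡; T-∧; T-∨; ∧-identityʳ; ∨-zeroʳ)
open import Data.Empty using (⊥-elim)
open import Data.List using (List; []; _∷_; _++_; [_]; map; concatMap; foldl; filterᵇ; length; upTo)
open import Data.List.Membership.Propositional using (_∈_; find; lose)
open import Data.List.Membership.Propositional.Properties
  using (∈-map⁺; ∈-map⁻; ∈-upTo⁺; ∈-upTo⁻; ∈-concatMap⁺; ∈-concatMap⁻; ∈-filter⁺; ∈-filter⁻;
         ∈-++⁺ˡ; ∈-++⁺ʳ; ∈-++⁻)
open import Data.List.Properties
  using (foldl-++; upTo-∷ʳ; filter-++; length-++; map-++; map-∘; map-concatMap; concatMap-cong; length-filter;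
         length-upTo; filter-≐)
open import Data.List.Relation.Unary.Any using (here; there)
open import Data.List.Relation.Unary.All as All using (All; []; _∷_)
open import Data.Nat
open import Data.Integer as ℤ using (ℤ)
import Data.Integer.Properties as ℤₚ
open import Data.Nat.Properties
open import Data.Nat.DivMod using (m≡m%n+[m/n]*n; [m+kn]%n≡m%n; m<n⇒m%n≡m; m%n<n; m*n/n≡m; /-monoˡ-≤)
open import Data.Nat.Tactic.RingSolver using (solve-∀)
open import Data.Product using (∃; ∃₂; _×_; _,_; proj₁; proj₂)
open import Data.Unit using (⊤; tt)
open import Data.Sum using (_⊎_; inj₁; inj₂; [_,_]′)
import Data.Sum as Sum
open import Function using (_∘_; case_of_; Equivalence)
open import Relation.Binary.Definitions using (tri<; tri≈; tri>)
open import Relation.Nullary using (¬_; Dec; yes; no; contradiction)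
open import Relation.Nullary.Decidable using (T?)
open import Relation.Binary.PropositionalEquality hiding ([_])

_touches_ : Comparator → ℕ → Set
(u , v) touches r = r ≡ u ⊎ r ≡ v

touches? : ∀ c r → Dec (c touches r)
touches? (u , v) r with r ≟ u | r ≟ v
... | yes r≡u | _      = yes (inj₁ r≡u)
... | no  _   | yes r≡v = yes (inj₂ r≡v)
... | no r≢u  | no r≢v = no λ { (inj₁ r≡u) → r≢u r≡u ; (inj₂ r≡v) → r≢v r≡v }

Untouched : List Comparator → ℕ → Set
Untouched L r = ∀ {c} → c ∈ L → ¬ c touches r

Coherent : List Comparator → Set
Coherent L = ∀ {c c′ r} → c ∈ L → c′ ∈ L → c touches r → c′ touches r → c ≡ c′

touched-or-untouched : ∀ L r → (∃ λ c → c ∈ L × c touches r) ⊎ Untouched L r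
touched-or-untouched []      r = inj₂ λ ()
touched-or-untouched (d ∷ L) r with touches? d r | touched-or-untouched L r
... | yes d-r | _                    = inj₁ (d , here refl , d-r)
... | no  _   | inj₁ (c , c∈L , c-r) = inj₁ (c , there c∈L , c-r)
... | no ¬d-r | inj₂ untouched       = inj₂ λ { (here refl) → ¬d-r ; (there c∈L) → untouched c∈L }

≡ᵇ-false : ∀ {m n} → m ≢ n → (m ≡ᵇ n) ≡ false
≡ᵇ-false {m} {n} m≢n with m ≡ᵇ n in eq
... | true  = contradiction (≡ᵇ⇒≡ m n (Equivalence.from T-≡ eq)) m≢n
... | false = refl

≡ᵇ-true⇒≡ : ∀ m n → (m ≡ᵇ n) ≡ true → m ≡ n
≡ᵇ-true⇒≡ m n e = ≡ᵇ⇒≡ m n (Equivalence.from T-≡ e)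

≡ᵇ-false⇒≢ : ∀ m n → (m ≡ᵇ n) ≡ false → m ≢ n
≡ᵇ-false⇒≢ m n e m≡n = case trans (sym e) (Equivalence.to T-≡ (≡⇒≡ᵇ m n m≡n)) of λ ()

≡ᵇ-refl : ∀ n → (n ≡ᵇ n) ≡ true
≡ᵇ-refl n = Equivalence.to T-≡ (≡⇒≡ᵇ n n refl)

T-not-≡ᵇ⇒≢ : ∀ m n → T (not (m ≡ᵇ n)) → m ≢ n
T-not-≡ᵇ⇒≢ m n t = ≡ᵇ-false⇒≢ m n (Equivalence.to T-not-≡ t)

≢⇒T-not-≡ᵇ : ∀ m n → m ≢ n → T (not (m ≡ᵇ n))
≢⇒T-not-≡ᵇ m n m≢n = Equivalence.from T-not-≡ (≡ᵇ-false m≢n)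

applyComp-untouched : ∀ c x {r} → ¬ c touches r → applyComp c x r ≡ x r
applyComp-untouched (u , v) x {r} ¬c-r
  rewrite ≡ᵇ-false {r} {u} (¬c-r ∘ inj₁) | ≡ᵇ-false {r} {v} (¬c-r ∘ inj₂) = refl

applyComp-min : ∀ u v x → applyComp (u , v) x u ≡ x u ∧ x v
applyComp-min u v x rewrite ≡ᵇ-refl u = refl

applyComp-max : ∀ u v x → applyComp (u , v) x v ≡ x u ∨ x v
applyComp-max u v x with v ≟ u
... | yes refl rewrite ≡ᵇ-refl v with x v
...   | true  = refl
...   | false = refl
applyComp-max u v x | no v≢u rewrite ≡ᵇ-false v≢u | ≡ᵇ-refl v = refl

applyComp-local : ∀ u v x y {r} → (u , v) touches r → x u ≡ y u → x v ≡ y v →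
                  applyComp (u , v) x r ≡ applyComp (u , v) y r
applyComp-local u v x y (inj₁ refl) xu≡yu xv≡yv
  rewrite applyComp-min u v x | applyComp-min u v y | xu≡yu | xv≡yv = refl
applyComp-local u v x y (inj₂ refl) xu≡yu xv≡yv
  rewrite applyComp-max u v x | applyComp-max u v y | xu≡yu | xv≡yv = refl

applyComp-idem : ∀ c x {r} → c touches r → applyComp c (applyComp c x) r ≡ applyComp c x r
applyComp-idem (u , v) x (inj₁ refl)
  rewrite applyComp-min u v (applyComp (u , v) x) | applyComp-min u v x | applyComp-max u v x
  = absorb (x u) (x v)
  where
  absorb : ∀ a b → (a ∧ b) ∧ (a ∨ b) ≡ a ∧ b
  absorb true  b = ∧-identityʳ b
  absorb false b = refl
applyComp-idem (u , v) x (inj₂ refl)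
  rewrite applyComp-max u v (applyComp (u , v) x) | applyComp-min u v x | applyComp-max u v x
  = absorb (x u) (x v)
  where
  absorb : ∀ a b → (a ∧ b) ∨ (a ∨ b) ≡ a ∨ b
  absorb true  b = ∨-zeroʳ b
  absorb false b = refl

runStage-++ : ∀ L L′ x → runStage (L ++ L′) x ≡ runStage L′ (runStage L x)
runStage-++ L L′ x = foldl-++ (λ y c → applyComp c y) x L L′

runStage-untouched : ∀ L x {r} → Untouched L r → runStage L x r ≡ x r
runStage-untouched []      x untouched = refl
runStage-untouched (c ∷ L) x untouched =
  trans (runStage-untouched L (applyComp c x) (untouched ∘ there))
        (applyComp-untouched c x (untouched (here refl)))

-- r is touched only by copies of c, and applying c twice is applying it once
runStage-touched : ∀ L x {c r} → Coherent L → c ∈ L → c touches r →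
                   runStage L x r ≡ applyComp c x r
runStage-touched (d ∷ L) x {r = r} coh c∈ c-r with touched-or-untouched L r
runStage-touched (d ∷ L) x coh (here refl) c-r | inj₂ untouched = runStage-untouched L _ untouched
runStage-touched (d ∷ L) x coh (there c∈L) c-r | inj₂ untouched = ⊥-elim (untouched c∈L c-r)
runStage-touched (d ∷ L) x {c = u , v} {r} coh c∈ c-r | inj₁ (c′ , c′∈L , c′-r)
  with refl ← coh (there c′∈L) c∈ c′-r c-r =
  trans (runStage-touched L (applyComp d x) (λ m m′ → coh (there m) (there m′)) c′∈L c-r) after-d
  where
  after-d : applyComp (u , v) (applyComp d x) r ≡ applyComp (u , v) x r
  after-d with touches? d u | touches? d v
  ... | yes d-u | _ with refl ← coh (here refl) c∈ d-u (inj₁ refl) = applyComp-idem d x c-r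
  ... | no _ | yes d-v with refl ← coh (here refl) c∈ d-v (inj₂ refl) = applyComp-idem d x c-r
  ... | no ¬d-u | no ¬d-v =
    applyComp-local u v _ x c-r (applyComp-untouched d x ¬d-u) (applyComp-untouched d x ¬d-v)

runStage-cong : ∀ L L′ x r → Coherent L → (∀ {c} → c ∈ L → c ∈ L′) → (∀ {c} → c ∈ L′ → c ∈ L) →
                runStage L x r ≡ runStage L′ x r
runStage-cong L L′ x r coh L⊆L′ L′⊆L with touched-or-untouched L r
... | inj₁ (c , c∈L , c-r) =
  trans (runStage-touched L x coh c∈L c-r)
        (sym (runStage-touched L′ x (λ m m′ → coh (L′⊆L m) (L′⊆L m′)) (L⊆L′ c∈L) c-r))
... | inj₂ untouched =
  trans (runStage-untouched L x untouched) (sym (runStage-untouched L′ x (untouched ∘ L′⊆L)))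

-- Sorted 0/1 sequences as thresholds

T-ext : ∀ {x y} → (T x → T y) → (T y → T x) → x ≡ y
T-ext {true}  {true}  _ _ = refl
T-ext {true}  {false} f _ = ⊥-elim (f _)
T-ext {false} {true}  _ g = ⊥-elim (g _)
T-ext {false} {false} _ _ = refl

≤ᵇ-true : ∀ {m n} → m ≤ n → (m ≤ᵇ n) ≡ true
≤ᵇ-true m≤n = Equivalence.to T-≡ (≤⇒≤ᵇ m≤n)

≤ᵇ-false : ∀ {m n} → ¬ m ≤ n → (m ≤ᵇ n) ≡ false
≤ᵇ-false {m} {n} m≰n = T-ext (m≰n ∘ ≤ᵇ⇒≤ m n) λ ()

≤ᵇ-⊔ : ∀ a c i → (a ≤ᵇ i) ∧ (c ≤ᵇ i) ≡ (a ⊔ c ≤ᵇ i)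
≤ᵇ-⊔ a c i = T-ext
  (λ t → let (a≤i , c≤i) = Equivalence.to T-∧ t in ≤⇒≤ᵇ (⊔-lub (≤ᵇ⇒≤ a i a≤i) (≤ᵇ⇒≤ c i c≤i)))
  (λ t → let a⊔c≤i = ≤ᵇ⇒≤ (a ⊔ c) i t in
         Equivalence.from T-∧ (≤⇒≤ᵇ (m⊔n≤o⇒m≤o a c a⊔c≤i) , ≤⇒≤ᵇ (m⊔n≤o⇒n≤o a c a⊔c≤i)))

≤ᵇ-⊓ : ∀ a c i → (a ≤ᵇ i) ∨ (c ≤ᵇ i) ≡ (a ⊓ c ≤ᵇ i)
≤ᵇ-⊓ a c i = T-ext
  (λ t → ≤⇒≤ᵇ ([ (λ a≤i → ≤-trans (m⊓n≤m a c) (≤ᵇ⇒≤ a i a≤i))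
                         , (λ c≤i → ≤-trans (m⊓n≤n a c) (≤ᵇ⇒≤ c i c≤i)) ]′ (Equivalence.to T-∨ t)))
  (λ t → Equivalence.from T-∨ (Sum.map (λ e → ≤⇒≤ᵇ (subst (_≤ i) e (≤ᵇ⇒≤ (a ⊓ c) i t)))
                                             (λ e → ≤⇒≤ᵇ (subst (_≤ i) e (≤ᵇ⇒≤ (a ⊓ c) i t)))
                                             (⊓-sel a c)))

≤ᵇ-+ : ∀ a i h → (a ≤ᵇ i + h) ≡ (a ∸ h ≤ᵇ i)
≤ᵇ-+ a i h = T-ext
  (λ t → ≤⇒≤ᵇ (m≤n+o⇒m∸n≤o a h (subst (a ≤_) (+-comm i h) (≤ᵇ⇒≤ a (i + h) t))))
  (λ t → ≤⇒≤ᵇ (≤-trans (m≤n+m∸n a h)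
                        (subst (h + (a ∸ h) ≤_) (+-comm h i) (+-monoʳ-≤ h (≤ᵇ⇒≤ (a ∸ h) i t)))))

≤ᵇ-+-cancel : ∀ a i h → (a + h ≤ᵇ i + h) ≡ (a ≤ᵇ i)
≤ᵇ-+-cancel a i h = T-ext (λ t → ≤⇒≤ᵇ (+-cancelʳ-≤ h a i (≤ᵇ⇒≤ (a + h) (i + h) t)))
                          (λ t → ≤⇒≤ᵇ (+-monoˡ-≤ h (≤ᵇ⇒≤ a i t)))

Sorted : ℕ → (ℕ → Bool) → Set
Sorted n f = ∀ l l′ → l < l′ → l′ < n → f l ≡ true → f l′ ≡ true

IsThreshold : ℕ → (ℕ → Bool) → ℕ → Set
IsThreshold n f a = ∀ l → l < n → f l ≡ (a ≤ᵇ l)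

sorted⇒threshold : ∀ n f → Sorted n f → ∃ λ a → a ≤ n × IsThreshold n f a
sorted⇒threshold zero    f sorted = 0 , z≤n , λ l ()
sorted⇒threshold (suc n) f sorted
  with a , a≤n , thr ← sorted⇒threshold n f (λ l l′ l<l′ l′<n → sorted l l′ l<l′ (m<n⇒m<1+n l′<n))
  with f n in fn
... | true = a , m≤n⇒m≤1+n a≤n , thr′
  where
  thr′ : IsThreshold (suc n) f a
  thr′ l l<1+n with m<1+n⇒m<n∨m≡n l<1+n
  ... | inj₁ l<n  = thr l l<n
  ... | inj₂ refl = trans fn (sym (≤ᵇ-true a≤n))
... | false = suc n , ≤-refl , thr′
  where
  thr′ : IsThreshold (suc n) f (suc n)
  thr′ l l<1+n with f l in fl
  ... | false = sym (≤ᵇ-false (<⇒≱ l<1+n))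
  ... | true with m<1+n⇒m<n∨m≡n l<1+n
  ...   | inj₁ l<n  = case trans (sym (sorted l n l<n ≤-refl fl)) fn of λ ()
  ...   | inj₂ refl = case trans (sym fl) fn of λ ()

count-threshold : ∀ n f a → IsThreshold n f a → length (filterᵇ f (upTo n)) ≡ n ∸ a
count-threshold zero    f a thr = sym (0∸n≡0 a)
count-threshold (suc n) f a thr = begin
  length (filterᵇ f (upTo (suc n)))
    ≡⟨ cong (length ∘ filterᵇ f) (sym (upTo-∷ʳ n)) ⟩
  length (filterᵇ f (upTo n ++ [ n ]))
    ≡⟨ cong length (filter-++ (T? ∘ f) (upTo n) [ n ]) ⟩
  length (filterᵇ f (upTo n) ++ filterᵇ f [ n ])
    ≡⟨ length-++ (filterᵇ f (upTo n)) ⟩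
  length (filterᵇ f (upTo n)) + length (filterᵇ f [ n ])
    ≡⟨ cong₂ _+_ (count-threshold n f a (λ l l<n → thr l (m<n⇒m<1+n l<n))) last-row ⟩
  n ∸ a + (if a ≤ᵇ n then 1 else 0)
    ≡⟨ add-last ⟩
  suc n ∸ a ∎
  where
  open ≡-Reasoning
  last-row : length (filterᵇ f [ n ]) ≡ (if a ≤ᵇ n then 1 else 0)
  last-row with f n | thr n ≤-refl
  ... | true  | fn rewrite sym fn = refl
  ... | false | fn rewrite sym fn = refl
  add-last : n ∸ a + (if a ≤ᵇ n then 1 else 0) ≡ suc n ∸ a
  add-last with a ≤? n
  ... | yes a≤n rewrite ≤ᵇ-true a≤n = sym (trans (cong (_∸ a) (+-comm 1 n)) (+-∸-comm 1 a≤n))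
  ... | no  a≰n rewrite ≤ᵇ-false a≰n
    = trans (+-identityʳ (n ∸ a)) (trans (m≤n⇒m∸n≡0 (<⇒≤ (≰⇒> a≰n))) (sym (m≤n⇒m∸n≡0 (≰⇒> a≰n))))

-- From numbers of zeros to numbers of ones

∸-⊔-∸ : ∀ n a β h → β ≤ n → n ∸ (a ⊔ (β ∸ h)) ≡ (n ∸ a) ⊓ (n ∸ β + h)
∸-⊔-∸ n a β h β≤n = trans (∸-distribˡ-⊔-⊓ n a (β ∸ h)) (shift h β≤n)
  where
  shift : ∀ h → β ≤ n → (n ∸ a) ⊓ (n ∸ (β ∸ h)) ≡ (n ∸ a) ⊓ (n ∸ β + h)
  shift h β≤n with h ≤? β
  ... | yes h≤β = cong ((n ∸ a) ⊓_) (+-cancelʳ-≡ (β ∸ h) _ _ (begin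
    n ∸ (β ∸ h) + (β ∸ h)  ≡⟨ m∸n+n≡m (≤-trans (m∸n≤m β h) β≤n) ⟩
    n                      ≡⟨ sym (m∸n+n≡m β≤n) ⟩
    n ∸ β + β              ≡⟨ cong ((n ∸ β) +_) (sym (m+[n∸m]≡n h≤β)) ⟩
    n ∸ β + (h + (β ∸ h))  ≡⟨ sym (+-assoc (n ∸ β) h (β ∸ h)) ⟩
    n ∸ β + h + (β ∸ h)    ∎))
    where open ≡-Reasoning
  ... | no h≰β rewrite m≤n⇒m∸n≡0 (<⇒≤ (≰⇒> h≰β)) =
    trans (m≤n⇒m⊓n≡m (m∸n≤m n a))
          (sym (m≤n⇒m⊓n≡m (≤-trans (m∸n≤m n a) (≤-trans (≤-reflexive (sym (m∸n+n≡m β≤n)))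
                                                          (+-monoʳ-≤ (n ∸ β) (<⇒≤ (≰⇒> h≰β)))))))

complement-⊔ : ∀ n a β h → β ≤ n →
                 ℤ.+ (n ∸ (a ⊔ (β ∸ h))) ≡ ℤ.+ (n ∸ a) ℤ.⊓ (ℤ.+ (n ∸ β) ℤ.+ ℤ.+ h)
complement-⊔ n a β h β≤n = cong ℤ.+_ (∸-⊔-∸ n a β h β≤n)

complement-⊓ : ∀ n a β h →
                 ℤ.+ (n ∸ ((a + h) ⊓ β)) ≡ (ℤ.+ (n ∸ a) ℤ.- ℤ.+ h) ℤ.⊔ ℤ.+ (n ∸ β)
complement-⊓ n a β h rewrite ∸-distribˡ-⊓-⊔ n (a + h) β | ℤₚ.[+m]-[+n]≡m⊖n (n ∸ a) h
  with h ≤? n ∸ a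
... | yes h≤ rewrite ℤₚ.⊖-≥ h≤ | ∸-+-assoc n a h = refl
... | no  h≰ rewrite sym (∸-+-assoc n a h) | m≤n⇒m∸n≡0 (<⇒≤ (≰⇒> h≰)) =
  sym (ℤₚ.i≤j⇒i⊔j≡j (subst (ℤ._≤ ℤ.+ (n ∸ β)) (sym (ℤₚ.⊖-< (≰⇒> h≰))) ℤₚ.neg-≤-pos))

∈-range⁻ : ∀ a c {i} → i ∈ range a c → a ≤ i × i ≤ c
∈-range⁻ a c i∈ with d , d∈ , refl ← ∈-map⁻ (a +_) i∈ with a ≤? suc c
... | yes a≤1+c = m≤m+n a d , s≤s⁻¹ (subst (suc (a + d) ≤_) (m+[n∸m]≡n a≤1+c) (+-monoʳ-< a (∈-upTo⁻ d∈)))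
... | no  a≰1+c = ⊥-elim (n≮0 (subst (d <_) (m≤n⇒m∸n≡0 (<⇒≤ (≰⇒> a≰1+c))) (∈-upTo⁻ d∈)))

∈-range⁺ : ∀ a c {i} → a ≤ i → i ≤ c → i ∈ range a c
∈-range⁺ a c {i} a≤i i≤c =
  subst (_∈ range a c) (m+[n∸m]≡n a≤i) (∈-map⁺ (a +_) (∈-upTo⁺ (∸-monoˡ-< (s≤s i≤c) a≤i)))

∈-range-0⁻ : ∀ {i c} d → d ≤ c → i ∈ range 0 (c ∸ d) → i + d ≤ c
∈-range-0⁻ {i} d d≤c i∈ = m≤o∸n⇒m+n≤o i d≤c (proj₂ (∈-range⁻ 0 _ i∈))

∈-range-0⁺ : ∀ {i c} d → i + d ≤ c → i ∈ range 0 (c ∸ d)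
∈-range-0⁺ {i} d i+d≤c = ∈-range⁺ 0 _ z≤n (m+n≤o⇒m≤o∸n i i+d≤c)

∈-if⁻ : ∀ {A : Set} {x : A} {c xs} → x ∈ (if c then xs else []) → T c × x ∈ xs
∈-if⁻ {c = true} x∈ = tt , x∈

∈-if⁺ : ∀ {A : Set} {x : A} {c xs} → T c → x ∈ xs → x ∈ (if c then xs else [])
∈-if⁺ {c = true} _ x∈ = x∈

-- Registers arranged in n rows of b columns

module Columns (b n : ℕ) where

  reg : ℕ → ℕ → ℕ
  reg t l = t + l * b

  IsColumn : ℕ → Set
  IsColumn t = 1 ≤ t × t ≤ b

  private
    reg-suc : ∀ t l → reg t (suc l) ≡ b + reg t l
    reg-suc t l = trans (cong (t +_) (+-comm b (l * b))) (trans (sym (+-assoc t (l * b) b)) (+-comm (reg t l) b))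

    reg-0<reg-suc : ∀ {t t′} l′ → IsColumn t → IsColumn t′ → reg t 0 ≢ reg t′ (suc l′)
    reg-0<reg-suc {t} {t′} l′ (_ , t≤b) (1≤t′ , _) e = <⇒≱ (s≤s t≤b) (begin
      suc b              ≡⟨ +-comm 1 b ⟩
      b + 1              ≤⟨ +-monoʳ-≤ b (≤-trans 1≤t′ (m≤m+n t′ (l′ * b))) ⟩
      b + reg t′ l′      ≡⟨ sym (reg-suc t′ l′) ⟩
      reg t′ (suc l′)    ≡⟨ sym e ⟩
      t + 0              ≡⟨ +-identityʳ t ⟩
      t                  ∎)
      where open ≤-Reasoning

  reg-injective : ∀ {t t′} l l′ → IsColumn t → IsColumn t′ → reg t l ≡ reg t′ l′ → t ≡ t′ × l ≡ l′
  reg-injective {t} {t′} zero    zero     _  _  e = trans (sym (+-identityʳ t)) (trans e (+-identityʳ t′)) , refl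
  reg-injective          zero    (suc l′) ct ct′ e = contradiction e (reg-0<reg-suc l′ ct ct′)
  reg-injective          (suc l) zero     ct ct′ e = contradiction (sym e) (reg-0<reg-suc l ct′ ct)
  reg-injective {t} {t′} (suc l) (suc l′) ct ct′ e
    with t≡t′ , l≡l′ ← reg-injective l l′ ct ct′
                         (+-cancelˡ-≡ b _ _ (trans (sym (reg-suc t l)) (trans e (reg-suc t′ l′))))
    = t≡t′ , cong suc l≡l′

  -- a family stands for the comparators [reg minCol i : reg maxCol (i + offset)], one per row i
  record Family : Set where
    constructor family
    field
      minCol maxCol offset : ℕ
  open Family public

  comparator : Family → ℕ → Comparator
  comparator (family A B h) i = reg A i , reg B (i + h)

  _hasColumn_ : Family → ℕ → Set
  f hasColumn t = t ≡ minCol f ⊎ t ≡ maxCol f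

  record Decomposition (Fs : List Family) (L : List Comparator) : Set where
    field
      minCol-column : ∀ {f} → f ∈ Fs → IsColumn (minCol f)
      maxCol-column : ∀ {f} → f ∈ Fs → IsColumn (maxCol f)
      minCol≢maxCol : ∀ {f} → f ∈ Fs → minCol f ≢ maxCol f
      disjoint    : ∀ {f f′ t} → f ∈ Fs → f′ ∈ Fs → f hasColumn t → f′ hasColumn t → f ≡ f′
      ∈⇒comparator : ∀ {c} → c ∈ L → ∃₂ λ f i → f ∈ Fs × i + offset f < n × c ≡ comparator f i
      comparator∈ : ∀ {f i} → f ∈ Fs → i + offset f < n → comparator f i ∈ L

  Position : Family → ℕ → ℕ → ℕ → Set
  Position f i t l = (t ≡ minCol f × l ≡ i) ⊎ (t ≡ maxCol f × l ≡ i + offset f)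

  module _ {Fs L} (D : Decomposition Fs L) where
    open Decomposition D

    touching : ∀ {c t l} → IsColumn t → c ∈ L → c touches reg t l →
               ∃₂ λ f i → f ∈ Fs × i + offset f < n × c ≡ comparator f i × Position f i t l
    touching {t = t} {l} ct c∈ c-r with ∈⇒comparator c∈
    ... | f@(family A B h) , i , f∈ , i+h<n , refl = f , i , f∈ , i+h<n , refl , position c-r
      where
      position : comparator f i touches reg t l → Position f i t l
      position (inj₁ e) = inj₁ (reg-injective l i ct (minCol-column f∈) e)
      position (inj₂ e) = inj₂ (reg-injective l (i + h) ct (maxCol-column f∈) e)

    same-position : ∀ {f i i′ t l} → f ∈ Fs → Position f i t l → Position f i′ t l → i ≡ i′
    same-position f∈ (inj₁ (_ , refl)) (inj₁ (_ , refl)) = refl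
    same-position f∈ (inj₁ (refl , _)) (inj₂ (e , _))    = contradiction e (minCol≢maxCol f∈)
    same-position f∈ (inj₂ (refl , _)) (inj₁ (e , _))    = contradiction (sym e) (minCol≢maxCol f∈)
    same-position {f} f∈ (inj₂ (_ , refl)) (inj₂ (_ , e)) = +-cancelʳ-≡ (offset f) _ _ e

    hasColumn-position : ∀ {f i t l} → Position f i t l → f hasColumn t
    hasColumn-position (inj₁ (e , _)) = inj₁ e
    hasColumn-position (inj₂ (e , _)) = inj₂ e

    coherent : Coherent L
    coherent {c} {c′} {r} c∈ c′∈ c-r c′-r with ∈⇒comparator c∈
    ... | f@(family A B h) , i , f∈ , _ , refl = own-position c-r
      where
      same : ∀ {t l} → IsColumn t → Position f i t l → c′ touches reg t l → comparator f i ≡ c′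
      same {l = l} ct pos c′-t with touching {l = l} ct c′∈ c′-t
      ... | f′ , i′ , f′∈ , _ , refl , pos′
        with refl ← disjoint f∈ f′∈ (hasColumn-position pos) (hasColumn-position pos′)
        with refl ← same-position f∈ pos pos′ = refl
      own-position : comparator f i touches r → comparator f i ≡ c′
      own-position (inj₁ refl) = same (minCol-column f∈) (inj₁ (refl , refl)) c′-r
      own-position (inj₂ refl) = same (maxCol-column f∈) (inj₂ (refl , refl)) c′-r

    untouched-min : ∀ {f i} → f ∈ Fs → n ≤ i + offset f → Untouched L (reg (minCol f) i)
    untouched-min {i = i} f∈ n≤i+h c∈ c-r with touching {l = i} (minCol-column f∈) c∈ c-r
    ... | f′ , i′ , f′∈ , i′+h<n , refl , pos′
      with refl ← disjoint f∈ f′∈ (inj₁ refl) (hasColumn-position pos′)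
      with refl ← same-position f∈ (inj₁ (refl , refl)) pos′ = <⇒≱ i′+h<n n≤i+h

    untouched-max : ∀ {f r} → f ∈ Fs → r < offset f → Untouched L (reg (maxCol f) r)
    untouched-max {r = r} f∈ r<h c∈ c-r with touching {l = r} (maxCol-column f∈) c∈ c-r
    ... | f′ , i′ , f′∈ , _ , refl , pos′
      with refl ← disjoint f∈ f′∈ (inj₂ refl) (hasColumn-position pos′)
      with pos′
    ... | inj₁ (B≡A , _)   = minCol≢maxCol f∈ (sym B≡A)
    ... | inj₂ (_ , refl) = <⇒≱ r<h (m≤n+m _ i′)

    untouched-other : ∀ {t l} → IsColumn t → (∀ {f} → f ∈ Fs → ¬ f hasColumn t) → Untouched L (reg t l)
    untouched-other {l = l} ct free c∈ c-r with touching {l = l} ct c∈ c-r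
    ... | _ , _ , f∈ , _ , _ , pos = free f∈ (hasColumn-position pos)

  ColumnThresholds : (ℕ → Bool) → (ℕ → ℕ) → Set
  ColumnThresholds x z = ∀ {t} → IsColumn t → IsThreshold n (λ l → x (reg t l)) (z t)

  module _ {Fs L} (D : Decomposition Fs L) {x z} (bounded : ∀ u → z u ≤ n) (thr : ColumnThresholds x z) where
    open Decomposition D

    after-min : ∀ {f} → f ∈ Fs → ∀ i → i < n →
                runStage L x (reg (minCol f) i) ≡ (z (minCol f) ⊔ (z (maxCol f) ∸ offset f) ≤ᵇ i)
    after-min {family A B h} f∈ i i<n with i + h <? n
    ... | yes i+h<n = begin
      runStage L x (reg A i)                 ≡⟨ runStage-touched L x (coherent D) (comparator∈ f∈ i+h<n) (inj₁ refl) ⟩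
      applyComp (comparator (family A B h) i) x (reg A i) ≡⟨ applyComp-min (reg A i) (reg B (i + h)) x ⟩
      x (reg A i) ∧ x (reg B (i + h))        ≡⟨ cong₂ _∧_ (thr cA i i<n) (thr cB (i + h) i+h<n) ⟩
      (z A ≤ᵇ i) ∧ (z B ≤ᵇ i + h)            ≡⟨ cong ((z A ≤ᵇ i) ∧_) (≤ᵇ-+ (z B) i h) ⟩
      (z A ≤ᵇ i) ∧ (z B ∸ h ≤ᵇ i)            ≡⟨ ≤ᵇ-⊔ (z A) (z B ∸ h) i ⟩
      (z A ⊔ (z B ∸ h) ≤ᵇ i)                 ∎
      where
      open ≡-Reasoning
      cA = minCol-column f∈
      cB = maxCol-column f∈
    ... | no i+h≮n = begin
      runStage L x (reg A i)                 ≡⟨ runStage-untouched L x (untouched-min D f∈ (≮⇒≥ i+h≮n)) ⟩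
      x (reg A i)                            ≡⟨ thr cA i i<n ⟩
      (z A ≤ᵇ i)                             ≡⟨ sym (∧-identityʳ _) ⟩
      (z A ≤ᵇ i) ∧ true                      ≡⟨ cong ((z A ≤ᵇ i) ∧_) (sym zB-below) ⟩
      (z A ≤ᵇ i) ∧ (z B ∸ h ≤ᵇ i)            ≡⟨ ≤ᵇ-⊔ (z A) (z B ∸ h) i ⟩
      (z A ⊔ (z B ∸ h) ≤ᵇ i)                 ∎
      where
      open ≡-Reasoning
      cA = minCol-column f∈
      zB-below : (z B ∸ h ≤ᵇ i) ≡ true
      zB-below = trans (sym (≤ᵇ-+ (z B) i h))
                       (≤ᵇ-true (≤-trans (bounded B) (≮⇒≥ i+h≮n)))

    after-max : ∀ {f} → f ∈ Fs → ∀ r → r < n →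
                runStage L x (reg (maxCol f) r) ≡ ((z (minCol f) + offset f) ⊓ z (maxCol f) ≤ᵇ r)
    after-max {family A B h} f∈ r r<n with h ≤? r
    ... | yes h≤r with i ← r ∸ h | refl ← m∸n+n≡m h≤r = begin
      runStage L x (reg B (i + h))           ≡⟨ runStage-touched L x (coherent D) (comparator∈ f∈ r<n) (inj₂ refl) ⟩
      applyComp (comparator (family A B h) i) x (reg B (i + h)) ≡⟨ applyComp-max (reg A i) (reg B (i + h)) x ⟩
      x (reg A i) ∨ x (reg B (i + h))        ≡⟨ cong₂ _∨_ (thr cA i (≤-<-trans (m≤m+n i h) r<n))
                                                          (thr cB (i + h) r<n) ⟩
      (z A ≤ᵇ i) ∨ (z B ≤ᵇ i + h)            ≡⟨ cong (_∨ (z B ≤ᵇ i + h)) (sym (≤ᵇ-+-cancel (z A) i h)) ⟩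
      (z A + h ≤ᵇ i + h) ∨ (z B ≤ᵇ i + h)    ≡⟨ ≤ᵇ-⊓ (z A + h) (z B) (i + h) ⟩
      ((z A + h) ⊓ z B ≤ᵇ i + h)             ∎
      where
      open ≡-Reasoning
      cA = minCol-column f∈
      cB = maxCol-column f∈
    ... | no h≰r = begin
      runStage L x (reg B r)                 ≡⟨ runStage-untouched L x (untouched-max D f∈ (≰⇒> h≰r)) ⟩
      x (reg B r)                            ≡⟨ thr cB r r<n ⟩
      (z B ≤ᵇ r)                             ≡⟨ cong (_∨ (z B ≤ᵇ r)) (sym zA-above) ⟩
      (z A + h ≤ᵇ r) ∨ (z B ≤ᵇ r)            ≡⟨ ≤ᵇ-⊓ (z A + h) (z B) r ⟩
      ((z A + h) ⊓ z B ≤ᵇ r)                 ∎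
      where
      open ≡-Reasoning
      cB = maxCol-column f∈
      zA-above : (z A + h ≤ᵇ r) ≡ false
      zA-above = ≤ᵇ-false (λ le → h≰r (≤-trans (m≤n+m h (z A)) le))

    after-other : ∀ {t} → IsColumn t → (∀ {f} → f ∈ Fs → ¬ f hasColumn t) → ∀ l → l < n →
                  runStage L x (reg t l) ≡ (z t ≤ᵇ l)
    after-other ct free l l<n = trans (runStage-untouched L x (untouched-other D {l = l} ct free)) ((thr ct) l l<n)

odd≢even : ∀ x y → suc (x + x) ≢ y + y
odd≢even zero    zero    ()
odd≢even zero    (suc y) e = 0≢1+n (trans (suc-injective e) (+-suc y y))
odd≢even (suc x) zero    ()
odd≢even (suc x) (suc y) e =
  odd≢even x y (suc-injective (trans (sym (+-suc (suc x) x)) (trans (suc-injective e) (+-suc y y))))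

n≢n+1 : ∀ x → x ≢ x + 1
n≢n+1 x e = 1+n≢n (sym (trans e (+-comm x 1)))

module Operations (p k : ℕ) (1≤m : 1 ≤ hb p k) (2≤n : 2 ≤ nR k) (2≤k : 2 ≤ k) where

  b n m : ℕ
  b = bW p k
  n = nR k
  m = hb p k

  open Columns b n public

  b≡m+m : b ≡ m + m
  b≡m+m = cong (m +_) (+-identityʳ m)

  m≤b : m ≤ b
  m≤b = subst (m ≤_) (sym b≡m+m) (m≤m+n m m)

  m≤b∸j : ∀ {j} → j ≤ m → m ≤ b ∸ j
  m≤b∸j {j} j≤m = subst (m ≤_) (sym (trans (cong (_∸ j) b≡m+m) (+-∸-assoc m j≤m))) (m≤m+n m (m ∸ j))

  j<b∸j+1 : ∀ {j} → j ≤ m → j < b ∸ j + 1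
  j<b∸j+1 {j} j≤m = ≤-trans (s≤s j≤m) (subst (_≤ b ∸ j + 1) (+-comm m 1) (+-monoˡ-≤ 1 (m≤b∸j j≤m)))

  b∸j+1≤b : ∀ {j} → 1 ≤ j → j ≤ b → b ∸ j + 1 ≤ b
  b∸j+1≤b {j} 1≤j j≤b = subst (b ∸ j + 1 ≤_) (m∸n+n≡m j≤b) (+-monoʳ-≤ (b ∸ j) 1≤j)

  b∸j+1+j≡b+1 : ∀ {j} → j ≤ b → b ∸ j + 1 + j ≡ b + 1
  b∸j+1+j≡b+1 {j} j≤b = begin
    b ∸ j + 1 + j   ≡⟨ +-assoc (b ∸ j) 1 j ⟩
    b ∸ j + (1 + j) ≡⟨ cong ((b ∸ j) +_) (+-comm 1 j) ⟩
    b ∸ j + (j + 1) ≡⟨ sym (+-assoc (b ∸ j) j 1) ⟩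
    b ∸ j + j + 1   ≡⟨ cong (_+ 1) (m∸n+n≡m j≤b) ⟩
    b + 1           ∎
    where open ≡-Reasoning

  2^⟨k∸s∸1⟩≡hs+1 : ∀ s → 2 ^ (k ∸ s ∸ 1) ≡ hs k s + 1
  2^⟨k∸s∸1⟩≡hs+1 s = sym (m∸n+n≡m (m^n>0 2 (k ∸ s ∸ 1)))

  2^⟨k∸s∸1⟩≤n : ∀ s → 1 ≤ s → 2 ^ (k ∸ s ∸ 1) ≤ n
  2^⟨k∸s∸1⟩≤n s 1≤s =
    m+n≤o⇒m≤o∸n _ (subst (_≤ 2 ^ (k ∸ 1)) (+-comm 1 _) (^-monoʳ-< 2 (s≤s (s≤s z≤n)) (begin-strict
    k ∸ s ∸ 1  ≤⟨ ∸-monoˡ-≤ 1 (∸-monoʳ-≤ k 1≤s) ⟩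
    k ∸ 1 ∸ 1  <⟨ ∸-monoʳ-< ≤-refl (≤-trans (s≤s z≤n) (∸-monoˡ-≤ 1 2≤k)) ⟩
    k ∸ 1      ∎)))
    where open ≤-Reasoning

  data Op : Set where
    cycOp : Op
    movOp : ℕ → Op
    decOp : ℕ → ℕ → Op

  Valid : Op → Set
  Valid cycOp       = ⊤
  Valid (movOp j)   = 1 ≤ j × j ≤ m
  Valid (decOp j s) = 1 ≤ j × j ≤ m × 1 ≤ s

  -- literally the lists in S₁, Smov and Sdec, so that membership in them transfers definitionally
  comparators : Op → List Comparator
  comparators cycOp       = S₁ p k
  comparators (movOp j)   =
    concatMap (λ i → (b * i + j , b * i + j + 1) ∷ (b * i + (b ∸ j) , b * i + (b ∸ j) + 1) ∷ [])
              (range 0 (n ∸ 1))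
  comparators (decOp j s) =
    map (λ i → (b * i + j , b * (i + hs k s) + (b ∸ j) + 1)) (range 0 (n ∸ 2 ^ (k ∸ s ∸ 1)))

  families : Op → List Family
  families cycOp       = family b 1 1 ∷ []
  families (movOp j)   = family j (j + 1) 0 ∷ family (b ∸ j) (b ∸ j + 1) 0 ∷ []
  families (decOp j s) = family j (b ∸ j + 1) (hs k s) ∷ []

  private
    pair-≡ : ∀ {u u′ v v′ : ℕ} → u ≡ u′ → v ≡ v′ → (u , v) ≡ (u′ , v′)
    pair-≡ refl refl = refl

    reg-min : ∀ b i j → b * i + j ≡ j + i * b
    reg-min = solve-∀
    reg-max : ∀ b i h x → b * (i + h) + x + 1 ≡ x + 1 + (i + h) * b
    reg-max = solve-∀
    reg-mov : ∀ b i j → b * i + j + 1 ≡ j + 1 + (i + 0) * b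
    reg-mov = solve-∀
    reg-cyc-min : ∀ b i → b * suc i ≡ b + i * b
    reg-cyc-min = solve-∀
    reg-cyc-max : ∀ b i → b * suc i + 1 ≡ 1 + (i + 1) * b
    reg-cyc-max = solve-∀
    odd-form : ∀ j → suc (j + j) ≡ j + 1 + j
    odd-form = solve-∀

    1≤b : 1 ≤ b
    1≤b = ≤-trans 1≤m m≤b

    +1≡suc+0 : ∀ i → i + 1 ≡ suc (i + 0)
    +1≡suc+0 i = trans (+-comm i 1) (cong suc (sym (+-identityʳ i)))

  cyc-decomposition : Decomposition (families cycOp) (comparators cycOp)
  cyc-decomposition = record
    { minCol-column = λ { (here refl) → 1≤b , ≤-refl }
    ; maxCol-column = λ { (here refl) → ≤-refl , 1≤b }
    ; minCol≢maxCol = λ { (here refl) → b≢1 }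
    ; disjoint     = λ { (here refl) (here refl) _ _ → refl }
    ; ∈⇒comparator = ∈⇒comparator
    ; comparator∈  = λ { {i = i} (here refl) i+1<n →
        subst (_∈ S₁ p k) (pair-≡ (reg-cyc-min b i) (reg-cyc-max b i))
              (∈-map⁺ (λ i → (b * i , b * i + 1)) (∈-range⁺ 1 (n ∸ 1) (s≤s z≤n) (m+n≤o⇒m≤o∸n (suc i) i+1<n))) }
    }
    where
    b≢1 : b ≢ 1
    b≢1 b≡1 = <⇒≱ (+-mono-≤ 1≤m 1≤m) (≤-reflexive (trans (sym b≡m+m) b≡1))
    ∈⇒comparator : ∀ {c} → c ∈ S₁ p k → ∃₂ λ f i → f ∈ families cycOp × i + offset f < n × c ≡ comparator f i
    ∈⇒comparator c∈ with i , i∈ , refl ← ∈-map⁻ (λ i → (b * i , b * i + 1)) c∈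
                     with s≤s {n = i′} z≤n , i≤n∸1 ← ∈-range⁻ 1 (n ∸ 1) i∈ =
      family b 1 1 , i′ , here refl , m≤o∸n⇒m+n≤o (suc i′) (≤-trans (s≤s z≤n) 2≤n) i≤n∸1 ,
      pair-≡ (reg-cyc-min b i′) (reg-cyc-max b i′)

  mov-decomposition : ∀ j → Valid (movOp j) → Decomposition (families (movOp j)) (comparators (movOp j))
  mov-decomposition j (1≤j , j≤m) = record
    { minCol-column = minCol-column
    ; maxCol-column = maxCol-column
    ; minCol≢maxCol = λ { (here refl) → n≢n+1 j ; (there (here refl)) → n≢n+1 (b ∸ j) }
    ; disjoint     = disjoint
    ; ∈⇒comparator = ∈⇒comparator
    ; comparator∈  = comparator∈
    }
    where
    j≤b = ≤-trans j≤m m≤b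
    left right : Family
    left  = family j (j + 1) 0
    right = family (b ∸ j) (b ∸ j + 1) 0
    minCol-column : ∀ {f} → f ∈ families (movOp j) → IsColumn (minCol f)
    minCol-column (here refl)         = 1≤j , j≤b
    minCol-column (there (here refl)) = ≤-trans 1≤m (m≤b∸j j≤m) , m∸n≤m b j
    maxCol-column : ∀ {f} → f ∈ families (movOp j) → IsColumn (maxCol f)
    maxCol-column (here refl)         = m≤n+m 1 j , subst (j + 1 ≤_) (sym b≡m+m) (+-mono-≤ j≤m 1≤m)
    maxCol-column (there (here refl)) = m≤n+m 1 (b ∸ j) , b∸j+1≤b 1≤j j≤b
    -- the two families meet only when j = b - j, and then they coincide
    left-right : ∀ {t} → left hasColumn t → right hasColumn t → left ≡ right
    left-right (inj₁ refl) (inj₁ j≡b∸j)   = cong (λ u → family u (u + 1) 0) j≡b∸j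
    left-right (inj₁ refl) (inj₂ j≡b∸j+1) = contradiction j≡b∸j+1 (<⇒≢ (j<b∸j+1 j≤m))
    left-right (inj₂ refl) (inj₁ j+1≡b∸j) =
      contradiction (trans (odd-form j) (trans (cong (_+ j) j+1≡b∸j) (trans (m∸n+n≡m j≤b) b≡m+m))) (odd≢even j m)
    left-right (inj₂ refl) (inj₂ e)       = cong (λ u → family u (u + 1) 0) (+-cancelʳ-≡ 1 j (b ∸ j) e)
    disjoint : ∀ {f f′ t} → f ∈ families (movOp j) → f′ ∈ families (movOp j) →
               f hasColumn t → f′ hasColumn t → f ≡ f′
    disjoint (here refl)         (here refl)         _  _  = refl
    disjoint (there (here refl)) (there (here refl)) _  _  = refl
    disjoint (here refl)         (there (here refl)) tl tr = left-right tl tr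
    disjoint (there (here refl)) (here refl)         tr tl = sym (left-right tl tr)
    pairs : ℕ → List Comparator
    pairs i = (b * i + j , b * i + j + 1) ∷ (b * i + (b ∸ j) , b * i + (b ∸ j) + 1) ∷ []
    ∈⇒comparator : ∀ {c} → c ∈ comparators (movOp j) →
                   ∃₂ λ f i → f ∈ families (movOp j) × i + offset f < n × c ≡ comparator f i
    row< : ∀ {i} → i ∈ range 0 (n ∸ 1) → i + 0 < n
    row< {i} i∈ = subst (_≤ n) (+1≡suc+0 i) (∈-range-0⁻ 1 (≤-trans (s≤s z≤n) 2≤n) i∈)
    ∈⇒comparator c∈ with i , i∈ , c∈pairs ← find (∈-concatMap⁻ pairs {xs = range 0 (n ∸ 1)} c∈) with c∈pairs
    ... | here refl = left , i , here refl , row< i∈ , pair-≡ (reg-min b i j) (reg-mov b i j)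
    ... | there (here refl) =
      right , i , there (here refl) , row< i∈ , pair-≡ (reg-min b i (b ∸ j)) (reg-mov b i (b ∸ j))
    comparator∈ : ∀ {f i} → f ∈ families (movOp j) → i + offset f < n → comparator f i ∈ comparators (movOp j)
    row∈ : ∀ {i} → i + 0 < n → i ∈ range 0 (n ∸ 1)
    row∈ {i} i+0<n = ∈-range-0⁺ 1 (subst (_≤ n) (sym (+1≡suc+0 i)) i+0<n)
    in-pairs : ∀ {f} i → f ∈ families (movOp j) → comparator f i ∈ pairs i
    in-pairs i (here refl)         = here (sym (pair-≡ (reg-min b i j) (reg-mov b i j)))
    in-pairs i (there (here refl)) = there (here (sym (pair-≡ (reg-min b i (b ∸ j)) (reg-mov b i (b ∸ j)))))
    comparator∈ {i = i} (here refl)         i+0<n = ∈-concatMap⁺ pairs (lose (row∈ i+0<n) (in-pairs i (here refl)))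
    comparator∈ {i = i} (there (here refl)) i+0<n =
      ∈-concatMap⁺ pairs (lose (row∈ i+0<n) (in-pairs i (there (here refl))))

  dec-decomposition : ∀ j s → Valid (decOp j s) → Decomposition (families (decOp j s)) (comparators (decOp j s))
  dec-decomposition j s (1≤j , j≤m , 1≤s) = record
    { minCol-column = λ { (here refl) → 1≤j , j≤b }
    ; maxCol-column = λ { (here refl) → m≤n+m 1 (b ∸ j) , b∸j+1≤b 1≤j j≤b }
    ; minCol≢maxCol = λ { (here refl) → <⇒≢ (j<b∸j+1 j≤m) }
    ; disjoint     = λ { (here refl) (here refl) _ _ → refl }
    ; ∈⇒comparator = ∈⇒comparator
    ; comparator∈  = λ { {i = i} (here refl) i+h<n →
        subst (_∈ comparators (decOp j s)) (pair-≡ (reg-min b i j) (reg-max b i h (b ∸ j)))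
              (∈-map⁺ comparatorAt (∈-range-0⁺ (2 ^ (k ∸ s ∸ 1)) (subst (_≤ n) (sym (i+2^⟨k∸s∸1⟩ i)) i+h<n))) }
    }
    where
    j≤b = ≤-trans j≤m m≤b
    h = hs k s
    comparatorAt : ℕ → Comparator
    comparatorAt i = b * i + j , b * (i + h) + (b ∸ j) + 1
    i+2^⟨k∸s∸1⟩ : ∀ i → i + 2 ^ (k ∸ s ∸ 1) ≡ suc (i + h)
    i+2^⟨k∸s∸1⟩ i = trans (cong (i +_) (trans (2^⟨k∸s∸1⟩≡hs+1 s) (+-comm h 1))) (+-suc i h)
    ∈⇒comparator : ∀ {c} → c ∈ comparators (decOp j s) →
                   ∃₂ λ f i → f ∈ families (decOp j s) × i + offset f < n × c ≡ comparator f i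
    ∈⇒comparator c∈ with i , i∈ , refl ← ∈-map⁻ comparatorAt c∈ =
      family j (b ∸ j + 1) h , i , here refl ,
      subst (_≤ n) (i+2^⟨k∸s∸1⟩ i) (∈-range-0⁻ (2 ^ (k ∸ s ∸ 1)) (2^⟨k∸s∸1⟩≤n s 1≤s) i∈) ,
      pair-≡ (reg-min b i j) (reg-max b i h (b ∸ j))

  decomposition : ∀ o → Valid o → Decomposition (families o) (comparators o)
  decomposition cycOp       _ = cyc-decomposition
  decomposition (movOp j)   v = mov-decomposition j v
  decomposition (decOp j s) v = dec-decomposition j s v

  vecMap : Op → Vecb → Vecb
  vecMap cycOp       = cyc b
  vecMap (movOp j)   = mov b j
  vecMap (decOp j s) = dec b j (hs k s)

  -- vecMap o transported to the numbers of zeros n - c_t of the columns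
  zerosAfter : Op → (ℕ → ℕ) → ℕ → ℕ
  zerosAfter cycOp z t =
    if t ≡ᵇ 1 then (z b + 1) ⊓ z 1
    else if t ≡ᵇ b then z b ⊔ (z 1 ∸ 1)
    else z t
  zerosAfter (movOp j) z t =
    if (t ≡ᵇ j) ∨ (t ≡ᵇ b ∸ j) then z t ⊔ z (suc t)
    else if (t ≡ᵇ j + 1) ∨ (t ≡ᵇ b ∸ j + 1) then z (t ∸ 1) ⊓ z t
    else z t
  zerosAfter (decOp j s) z t =
    if t ≡ᵇ j then z j ⊔ (z (b ∸ j + 1) ∸ hs k s)
    else if t ≡ᵇ b ∸ j + 1 then (z j + hs k s) ⊓ z (b ∸ j + 1)
    else z t

  zerosAfter-≤ : ∀ o z → (∀ u → z u ≤ n) → ∀ t → zerosAfter o z t ≤ n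
  zerosAfter-≤ cycOp z bounded t with t ≡ᵇ 1 | t ≡ᵇ b
  ... | true  | _     = ≤-trans (m⊓n≤n _ (z 1)) (bounded 1)
  ... | false | true  = ⊔-lub (bounded b) (≤-trans (m∸n≤m (z 1) 1) (bounded 1))
  ... | false | false = bounded t
  zerosAfter-≤ (movOp j) z bounded t with (t ≡ᵇ j) ∨ (t ≡ᵇ b ∸ j) | (t ≡ᵇ j + 1) ∨ (t ≡ᵇ b ∸ j + 1)
  ... | true  | _     = ⊔-lub (bounded t) (bounded (suc t))
  ... | false | true  = ≤-trans (m⊓n≤n _ (z t)) (bounded t)
  ... | false | false = bounded t
  zerosAfter-≤ (decOp j s) z bounded t with t ≡ᵇ j | t ≡ᵇ b ∸ j + 1
  ... | true  | _     = ⊔-lub (bounded j) (≤-trans (m∸n≤m _ (hs k s)) (bounded _))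
  ... | false | true  = ≤-trans (m⊓n≤n _ _) (bounded _)
  ... | false | false = bounded t

  ones-after : ∀ o z → (∀ u → z u ≤ n) → ∀ t →
               ℤ.+ (n ∸ zerosAfter o z t) ≡ vecMap o (λ u → ℤ.+ (n ∸ z u)) t
  ones-after cycOp z bounded t with t ≡ᵇ 1 | t ≡ᵇ b
  ... | true  | _     = trans (complement-⊓ n (z b) (z 1) 1) (ℤₚ.⊔-comm _ _)
  ... | false | true  = trans (complement-⊔ n (z b) (z 1) 1 (bounded 1)) (ℤₚ.⊓-comm _ _)
  ... | false | false = refl
  ones-after (movOp j) z bounded t with (t ≡ᵇ j) ∨ (t ≡ᵇ b ∸ j) | (t ≡ᵇ j + 1) ∨ (t ≡ᵇ b ∸ j + 1)
  ... | true  | _     = cong ℤ.+_ (∸-distribˡ-⊔-⊓ n (z t) (z (suc t)))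
  ... | false | true  = cong ℤ.+_ (∸-distribˡ-⊓-⊔ n (z (t ∸ 1)) (z t))
  ... | false | false = refl
  ones-after (decOp j s) z bounded t with t ≡ᵇ j | t ≡ᵇ b ∸ j + 1
  ... | true  | _     = complement-⊔ n (z j) (z (b ∸ j + 1)) (hs k s) (bounded _)
  ... | false | true  = complement-⊓ n (z j) (z (b ∸ j + 1)) (hs k s)
  ... | false | false = refl

  vecMap-cong : ∀ o {c c′} → (∀ u → c u ≡ c′ u) → ∀ t → vecMap o c t ≡ vecMap o c′ t
  vecMap-cong cycOp c≗c′ t with t ≡ᵇ 1 | t ≡ᵇ b
  ... | true  | _     = cong₂ ℤ._⊔_ (c≗c′ 1) (cong (ℤ._- ℤ.+ 1) (c≗c′ b))
  ... | false | true  = cong₂ ℤ._⊓_ (cong (ℤ._+ ℤ.+ 1) (c≗c′ 1)) (c≗c′ b)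
  ... | false | false = c≗c′ t
  vecMap-cong (movOp j) c≗c′ t with (t ≡ᵇ j) ∨ (t ≡ᵇ b ∸ j) | (t ≡ᵇ j + 1) ∨ (t ≡ᵇ b ∸ j + 1)
  ... | true  | _     = cong₂ ℤ._⊓_ (c≗c′ t) (c≗c′ (suc t))
  ... | false | true  = cong₂ ℤ._⊔_ (c≗c′ (t ∸ 1)) (c≗c′ t)
  ... | false | false = c≗c′ t
  vecMap-cong (decOp j s) c≗c′ t with t ≡ᵇ j | t ≡ᵇ b ∸ j + 1
  ... | true  | _     = cong₂ ℤ._⊓_ (c≗c′ j) (cong (ℤ._+ ℤ.+ hs k s) (c≗c′ _))
  ... | false | true  = cong₂ ℤ._⊔_ (cong (ℤ._- ℤ.+ hs k s) (c≗c′ j)) (c≗c′ _)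
  ... | false | false = c≗c′ t

  private
    left-neighbour : ∀ (z : ℕ → ℕ) u → z u + 0 ≡ z (u + 1 ∸ 1)
    left-neighbour z u = trans (+-identityʳ (z u)) (cong z (sym (m+n∸n≡m u 1)))

  thresholds-after : ∀ o → Valid o → ∀ {x z} → (∀ u → z u ≤ n) → ColumnThresholds x z →
                     ColumnThresholds (runStage (comparators o) x) (zerosAfter o z)
  thresholds-after cycOp v {z = z} bounded thr {t} ct l l<n with t ≡ᵇ 1 in t≟1 | t ≡ᵇ b in t≟b
  ... | true  | _    with refl ← ≡ᵇ-true⇒≡ t 1 t≟1 = after-max (decomposition cycOp v) bounded thr (here refl) l l<n
  ... | false | true with refl ← ≡ᵇ-true⇒≡ t b t≟b = after-min (decomposition cycOp v) bounded thr (here refl) l l<n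
  ... | false | false = after-other (decomposition cycOp v) bounded thr ct free l l<n
    where
    free : ∀ {f} → f ∈ families cycOp → ¬ f hasColumn t
    free (here refl) (inj₁ t≡b) = ≡ᵇ-false⇒≢ t b t≟b t≡b
    free (here refl) (inj₂ t≡1) = ≡ᵇ-false⇒≢ t 1 t≟1 t≡1
  thresholds-after (decOp j s) v {z = z} bounded thr {t} ct l l<n with t ≡ᵇ j in t≟j | t ≡ᵇ b ∸ j + 1 in t≟j′
  ... | true  | _    with refl ← ≡ᵇ-true⇒≡ t j t≟j =
    after-min (decomposition (decOp j s) v) bounded thr (here refl) l l<n
  ... | false | true with refl ← ≡ᵇ-true⇒≡ t (b ∸ j + 1) t≟j′ =
    after-max (decomposition (decOp j s) v) bounded thr (here refl) l l<n
  ... | false | false = after-other (decomposition (decOp j s) v) bounded thr ct free l l<n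
    where
    free : ∀ {f} → f ∈ families (decOp j s) → ¬ f hasColumn t
    free (here refl) (inj₁ t≡j)  = ≡ᵇ-false⇒≢ t j t≟j t≡j
    free (here refl) (inj₂ t≡j′) = ≡ᵇ-false⇒≢ t (b ∸ j + 1) t≟j′ t≡j′
  thresholds-after (movOp j) v {z = z} bounded thr {t} ct l l<n
    with t ≡ᵇ j in t≟j | t ≡ᵇ b ∸ j in t≟b∸j | t ≡ᵇ j + 1 in t≟j+1 | t ≡ᵇ b ∸ j + 1 in t≟b∸j+1
  ... | true  | _     | _     | _ with refl ← ≡ᵇ-true⇒≡ t j t≟j =
    trans (after-min (mov-decomposition j v) bounded thr (here refl) l l<n) (cong (λ u → z t ⊔ z u ≤ᵇ l) (+-comm t 1))
  ... | false | true  | _     | _ with refl ← ≡ᵇ-true⇒≡ t (b ∸ j) t≟b∸j =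
    trans (after-min (mov-decomposition j v) bounded thr (there (here refl)) l l<n) (cong (λ u → z t ⊔ z u ≤ᵇ l) (+-comm t 1))
  ... | false | false | true  | _ with refl ← ≡ᵇ-true⇒≡ t (j + 1) t≟j+1 =
    trans (after-max (mov-decomposition j v) bounded thr (here refl) l l<n)
          (cong (λ u → u ⊓ z (j + 1) ≤ᵇ l) (left-neighbour z j))
  ... | false | false | false | true with refl ← ≡ᵇ-true⇒≡ t (b ∸ j + 1) t≟b∸j+1 =
    trans (after-max (mov-decomposition j v) bounded thr (there (here refl)) l l<n)
          (cong (λ u → u ⊓ z (b ∸ j + 1) ≤ᵇ l) (left-neighbour z (b ∸ j)))
  ... | false | false | false | false = after-other (mov-decomposition j v) bounded thr ct free l l<n
    where
    free : ∀ {f} → f ∈ families (movOp j) → ¬ f hasColumn t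
    free (here refl)         (inj₁ e) = ≡ᵇ-false⇒≢ t j t≟j e
    free (here refl)         (inj₂ e) = ≡ᵇ-false⇒≢ t (j + 1) t≟j+1 e
    free (there (here refl)) (inj₁ e) = ≡ᵇ-false⇒≢ t (b ∸ j) t≟b∸j e
    free (there (here refl)) (inj₂ e) = ≡ᵇ-false⇒≢ t (b ∸ j + 1) t≟b∸j+1 e


  colOnes≤n : ∀ x t → colOnes p k x t ≤ n
  colOnes≤n x t = ≤-trans (length-filter (T? ∘ (λ l → x (reg t l))) (upTo n)) (≤-reflexive (length-upTo n))

  colOnes-cong : ∀ {x y} t → (∀ l → x (reg t l) ≡ y (reg t l)) → colOnes p k x t ≡ colOnes p k y t
  colOnes-cong t x≗y = cong length (filter-≐ (T? ∘ (λ l → _)) (T? ∘ (λ l → _))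
                                             ((λ {l} → subst T (x≗y l)) , (λ {l} → subst T (sym (x≗y l)))) (upTo n))

  sorted⇒thresholds : ∀ x → (∀ {t} → IsColumn t → Sorted n (λ l → x (reg t l))) →
                      ColumnThresholds x (λ u → n ∸ colOnes p k x u)
  sorted⇒thresholds x sorted {t} ct with a , a≤n , thr ← sorted⇒threshold n (λ l → x (reg t l)) (sorted ct) =
    subst (IsThreshold n (λ l → x (reg t l))) (sym zeros≡a) thr
    where
    zeros≡a : n ∸ colOnes p k x t ≡ a
    zeros≡a = trans (cong (n ∸_) (count-threshold n (λ l → x (reg t l)) a thr)) (m∸[m∸n]≡n a≤n)

  ones-after-ops : ∀ os → All Valid os → ∀ {x z c} → (∀ u → z u ≤ n) → ColumnThresholds x z →
                   (∀ u → c u ≡ ℤ.+ (n ∸ z u)) → ∀ {t} → IsColumn t →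
                   foldl (λ v f → f v) c (map vecMap os) t ≡ ℤ.+ colOnes p k (runStage (concatMap comparators os) x) t
  ones-after-ops []       []       {x} {z} bounded thr c≗ {t} ct =
    trans (c≗ t) (cong ℤ.+_ (sym (count-threshold n (λ l → x (reg t l)) (z t) (thr ct))))
  ones-after-ops (o ∷ os) (v ∷ vs) {x} {z} {c} bounded thr c≗ ct =
    trans (ones-after-ops os vs (zerosAfter-≤ o z bounded) (thresholds-after o v bounded thr) c′≗ ct)
          (cong (λ y → ℤ.+ colOnes p k y _) (sym (runStage-++ (comparators o) (concatMap comparators os) x)))
    where
    c′≗ : ∀ u → vecMap o c u ≡ ℤ.+ (n ∸ zerosAfter o z u)
    c′≗ u = trans (vecMap-cong o c≗ u) (sym (ones-after o z bounded u))

-- p is written 4 + q, so that p ∸ 2 reduces to 2 + q and p is visibly nonzero for _%_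
module Residues (q : ℕ) where

  P : ℕ
  P = 4 + q

  %-≡ : ∀ {a} Q r → a ≡ r + Q * P → r < P → a % P ≡ r
  %-≡ Q r refl r<P = trans ([m+kn]%n≡m%n r Q P) (m<n⇒m%n≡m r<P)

  %≡⇒ : ∀ a {r} → a % P ≡ r → a ≡ r + a / P * P
  %≡⇒ a a%P≡r = trans (m≡m%n+[m/n]*n a P) (cong (_+ a / P * P) a%P≡r)

  2%P≡2 : 2 % P ≡ 2
  2%P≡2 = m<n⇒m%n≡m {n = P} (s≤s (s≤s (s≤s z≤n)))

  suc-residue : ∀ a {r} → a % P ≡ r → suc r < P → suc a % P ≡ suc r
  suc-residue a {r} a%P≡r 1+r<P =
    %-≡ (a / P) (suc r) (cong suc (%≡⇒ a a%P≡r)) 1+r<P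

  suc-residue-∉ : ∀ a {e} → a % P ≡ suc e → 1 ≤ e → suc a % P ≢ 1 × suc a % P ≢ 2
  suc-residue-∉ a {e} a%P≡1+e 1≤e with suc (suc e) <? P
  ... | yes 2+e<P = (λ eq → case trans (sym next) eq of λ ())
                  , (λ eq → <⇒≢ 1≤e (sym (suc-injective (suc-injective (trans (sym next) eq)))))
    where next = suc-residue a a%P≡1+e 2+e<P
  ... | no 2+e≮P = (λ eq → case trans (sym next) eq of λ ()) , (λ eq → case trans (sym next) eq of λ ())
    where
    2+e≡P : suc (suc e) ≡ P
    2+e≡P = ≤-antisym (subst (_< P) a%P≡1+e (m%n<n a P)) (≮⇒≥ 2+e≮P)
    next : suc a % P ≡ 0
    next = %-≡ (suc (a / P)) 0 (cong suc (%≡⇒ a (trans a%P≡1+e (suc-injective 2+e≡P)))) (s≤s z≤n)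

  -- m ≡ j (mod p), stated without subtraction
  stage-index : ∀ j A Q m → j + P * A ≡ P * Q + m → 1 ≤ m → j ≤ P → ∃ λ i → m ≡ j + P * i
  stage-index j A Q m eq 1≤m j≤P with Q ≤? A
  ... | yes Q≤A = A ∸ Q , +-cancelˡ-≡ (P * Q) m (j + P * (A ∸ Q)) (sym (begin
    P * Q + (j + P * (A ∸ Q)) ≡⟨ regroup j Q (A ∸ Q) q ⟩
    j + P * (Q + (A ∸ Q))     ≡⟨ cong (λ u → j + P * u) (m+[n∸m]≡n Q≤A) ⟩
    j + P * A                 ≡⟨ eq ⟩
    P * Q + m                 ∎))
    where
    open ≡-Reasoning
    regroup : ∀ j Q d q → (4 + q) * Q + (j + (4 + q) * d) ≡ j + (4 + q) * (Q + d)
    regroup = solve-∀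
  ... | no Q≰A = contradiction eq (<⇒≢ (begin-strict
    j + P * A        ≤⟨ +-monoˡ-≤ (P * A) j≤P ⟩
    P + P * A        ≡⟨ sym (*-suc P A) ⟩
    P * suc A        ≤⟨ *-monoʳ-≤ P (≰⇒> Q≰A) ⟩
    P * Q            <⟨ m<m+n (P * Q) 1≤m ⟩
    P * Q + m        ∎))
    where open ≤-Reasoning

  -- S_{(p-1)jj+1} ⊆ T_j  iff  j + jj ≡ 1 (mod p)
  mov-residue : ∀ j jj i → j + P * i ≡ (3 + q) * jj + 1 → (j + jj) % P ≡ 1
  mov-residue j jj i eq = trans (sym ([m+kn]%n≡m%n (j + jj) i P)) (%-≡ jj 1 (begin
    j + jj + i * P        ≡⟨ regroup j jj i q ⟩
    j + P * i + jj        ≡⟨ cong (_+ jj) eq ⟩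
    (3 + q) * jj + 1 + jj ≡⟨ collect jj q ⟩
    1 + jj * P            ∎) (s≤s (s≤s z≤n)))
    where
    open ≡-Reasoning
    regroup : ∀ j jj i q → j + jj + i * (4 + q) ≡ j + (4 + q) * i + jj
    regroup = solve-∀
    collect : ∀ jj q → (3 + q) * jj + 1 + jj ≡ 1 + jj * (4 + q)
    collect = solve-∀

  mov-stage : ∀ j jj → j ≤ P → (j + jj) % P ≡ 1 → ∃ λ i → (3 + q) * jj + 1 ≡ j + P * i
  mov-stage j jj j≤P j+jj%P≡1 = stage-index j jj Q ((3 + q) * jj + 1) (begin
    j + P * jj                  ≡⟨ split j jj q ⟩
    (j + jj) + (3 + q) * jj     ≡⟨ cong (_+ (3 + q) * jj) (%≡⇒ (j + jj) j+jj%P≡1) ⟩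
    1 + Q * P + (3 + q) * jj    ≡⟨ collect Q jj q ⟩
    P * Q + ((3 + q) * jj + 1)  ∎) (m≤n+m 1 _) j≤P
    where
    open ≡-Reasoning
    Q = (j + jj) / P
    split : ∀ j jj q → j + (4 + q) * jj ≡ (j + jj) + (3 + q) * jj
    split = solve-∀
    collect : ∀ Q jj q → 1 + Q * (4 + q) + (3 + q) * jj ≡ (4 + q) * Q + ((3 + q) * jj + 1)
    collect = solve-∀

  -- so the columns jj, jj + 1, b - jj, b - jj + 1 of two maps mov_jj, mov_jj′ of Q_j do not meet
  mov-gap : ∀ j jj jj′ → (j + jj) % P ≡ 1 → (j + jj′) % P ≡ 1 → jj < jj′ → jj + 4 ≤ jj′
  mov-gap j jj jj′ j+jj%P≡1 j+jj′%P≡1 jj<jj′ = +-cancelˡ-≤ j (jj + 4) jj′ (begin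
    j + (jj + 4)         ≡⟨ sym (+-assoc j jj 4) ⟩
    j + jj + 4           ≡⟨ cong (_+ 4) (%≡⇒ (j + jj) j+jj%P≡1) ⟩
    1 + Q * P + 4        ≡⟨ cong suc (+-comm (Q * P) 4) ⟩
    1 + (4 + Q * P)      ≤⟨ s≤s (+-monoˡ-≤ (Q * P) (m≤m+n 4 q)) ⟩
    1 + (P + Q * P)      ≤⟨ s≤s (*-monoˡ-≤ P Q<Q′) ⟩
    1 + Q′ * P           ≡⟨ sym (%≡⇒ (j + jj′) j+jj′%P≡1) ⟩
    j + jj′              ∎)
    where
    open ≤-Reasoning
    Q  = (j + jj) / P
    Q′ = (j + jj′) / P
    Q<Q′ : Q < Q′
    Q<Q′ with Q <? Q′
    ... | yes lt = lt
    ... | no Q≮Q′ = contradiction (+-monoʳ-< j jj<jj′) (≤⇒≯ (begin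
      j + jj′        ≡⟨ %≡⇒ (j + jj′) j+jj′%P≡1 ⟩
      1 + Q′ * P     ≤⟨ s≤s (*-monoˡ-≤ P (≮⇒≥ Q≮Q′)) ⟩
      1 + Q * P      ≡⟨ sym (%≡⇒ (j + jj) j+jj%P≡1) ⟩
      j + jj         ∎))

  -- S_{jj+s} with (p-2)(jj-1) < s ≤ (p-2)jj, written s = (p-2)(jj-1) + e, lies in T_j
  -- iff j + jj - 1 ≡ 1 + e (mod p), which is possible iff j + jj ≢ 1, 2 (mod p)
  dec-residue : ∀ j0 jj0 i e → suc j0 + P * i ≡ suc jj0 + ((2 + q) * jj0 + e) → 1 ≤ e → e ≤ 2 + q →
                (j0 + suc jj0) % P ≡ suc e × (suc j0 + suc jj0) % P ≢ 1 × (suc j0 + suc jj0) % P ≢ 2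
  dec-residue j0 jj0 i e eq 1≤e e≤2+q = residue , suc-residue-∉ (j0 + suc jj0) residue 1≤e
    where
    residue : (j0 + suc jj0) % P ≡ suc e
    residue = trans (sym ([m+kn]%n≡m%n (j0 + suc jj0) i P)) (%-≡ jj0 (suc e) (begin
      j0 + suc jj0 + i * P                  ≡⟨ regroup j0 jj0 i q ⟩
      (j0 + P * i) + suc jj0                ≡⟨ cong (_+ suc jj0) (suc-injective eq) ⟩
      jj0 + ((2 + q) * jj0 + e) + suc jj0   ≡⟨ collect jj0 e q ⟩
      suc e + jj0 * P                       ∎) (s≤s (s≤s e≤2+q)))
      where
      open ≡-Reasoning
      regroup : ∀ j0 jj0 i q → j0 + suc jj0 + i * (4 + q) ≡ (j0 + (4 + q) * i) + suc jj0
      regroup = solve-∀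
      collect : ∀ jj0 e q → jj0 + ((2 + q) * jj0 + e) + suc jj0 ≡ suc e + jj0 * (4 + q)
      collect = solve-∀

  dec-stage : ∀ j0 jj0 → suc j0 ≤ P → (suc j0 + suc jj0) % P ≢ 1 → (suc j0 + suc jj0) % P ≢ 2 →
              ∃ λ e → (j0 + suc jj0) % P ≡ suc (suc e) ×
                      ∃ λ i → suc jj0 + ((2 + q) * jj0 + suc e) ≡ suc j0 + P * i
  dec-stage j0 jj0 j≤P ≢1 ≢2 with (j0 + suc jj0) % P in residue
  ... | zero        = contradiction (suc-residue (j0 + suc jj0) residue (s≤s (s≤s z≤n))) ≢1
  ... | suc zero    = contradiction (suc-residue (j0 + suc jj0) residue (s≤s (s≤s (s≤s z≤n)))) ≢2
  ... | suc (suc e) = e , refl , stage-index (suc j0) jj0 Q m (+-cancelʳ-≡ (suc jj0) _ _ (begin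
    suc j0 + P * jj0 + suc jj0               ≡⟨ regroup j0 jj0 q ⟩
    suc (j0 + suc jj0) + P * jj0             ≡⟨ cong (λ u → suc u + P * jj0) (%≡⇒ (j0 + suc jj0) residue) ⟩
    suc (suc (suc e) + Q * P) + P * jj0      ≡⟨ collect e Q jj0 q ⟩
    P * Q + m + suc jj0                      ∎)) (s≤s z≤n) j≤P
    where
    open ≡-Reasoning
    Q = (j0 + suc jj0) / P
    m = suc jj0 + ((2 + q) * jj0 + suc e)
    regroup : ∀ j0 jj0 q → suc j0 + (4 + q) * jj0 + suc jj0 ≡ suc (j0 + suc jj0) + (4 + q) * jj0
    regroup = solve-∀
    collect : ∀ e Q jj0 q → suc (suc (suc e) + Q * (4 + q)) + (4 + q) * jj0
                          ≡ (4 + q) * Q + (suc jj0 + ((2 + q) * jj0 + suc e)) + suc jj0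
    collect = solve-∀

≤-cdiv : ∀ jj a d → jj * suc d ≤ a → jj ≤ cdiv a (suc d)
≤-cdiv jj a d le = subst (_≤ (a + d) / suc d) (m*n/n≡m jj (suc d)) (/-monoˡ-≤ (suc d) (≤-trans le (m≤m+n a d)))

-- The stage T_j is made of the comparators of the maps in Q_j

module Stage (q k j0 : ℕ) (4+q≤k : 4 + q ≤ k) (j≤p : suc j0 ≤ 4 + q) where

  open Residues q

  j : ℕ
  j = suc j0

  private
    2≤k : 2 ≤ k
    2≤k = ≤-trans (s≤s (s≤s z≤n)) 4+q≤k

    1≤m : 1 ≤ hb P k
    1≤m = ≤-cdiv 1 (k ∸ 2) (suc q) (subst (_≤ k ∸ 2) (sym (*-identityˡ (2 + q))) (∸-monoˡ-≤ 2 4+q≤k))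

    2≤n : 2 ≤ nR k
    2≤n = m+n≤o⇒m≤o∸n 2 (≤-trans (s≤s (s≤s (s≤s z≤n)))
                                 (^-monoʳ-≤ 2 {2} (∸-monoˡ-≤ 1 (≤-trans (s≤s (s≤s (s≤s z≤n))) 4+q≤k))))

  open Operations P k 1≤m 2≤n 2≤k public

  movCondition : ℕ → Bool
  movCondition jj = (jj * (P ∸ 2) ≤ᵇ k ∸ 2) ∧ (modN (j + jj) P ≡ᵇ modN 1 P)

  decIndex : ℕ → ℕ
  decIndex jj = (P ∸ 2) * (jj ∸ 1) + modN (j + jj ∸ 1) P ∸ 1

  decCondition : ℕ → Bool
  decCondition jj = not (modN (j + jj) P ≡ᵇ 1) ∧ not (modN (j + jj) P ≡ᵇ 2) ∧ (decIndex jj ≤ᵇ k ∸ 1)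

  decOps : ℕ → List Op
  decOps jj = if decCondition jj then decOp jj (decIndex jj) ∷ [] else []

  cycOps : List Op
  cycOps = if j ≡ᵇ 1 then cycOp ∷ [] else []

  movIndices : List ℕ
  movIndices = filterᵇ movCondition (range 1 (k ∸ 2))

  -- the maps of Q_j, in the order in which Qmap composes them
  opsQ : List Op
  opsQ = cycOps ++ map movOp movIndices ++ concatMap decOps (range 1 m)

  Qmap-opsQ : ∀ c → Qmap P k j c ≡ foldl (λ v f → f v) c (map vecMap opsQ)
  Qmap-opsQ c = cong (foldl (λ v f → f v) c) (sym (begin
    map vecMap opsQ
      ≡⟨ map-++ vecMap cycOps _ ⟩
    map vecMap cycOps ++ map vecMap (map movOp movIndices ++ concatMap decOps (range 1 m))
      ≡⟨ cong₂ _++_ (map-if (j ≡ᵇ 1)) (map-++ vecMap (map movOp movIndices) _) ⟩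
    (if j ≡ᵇ 1 then cyc b ∷ [] else []) ++ map vecMap (map movOp movIndices)
      ++ map vecMap (concatMap decOps (range 1 m))
      ≡⟨ cong ((if j ≡ᵇ 1 then cyc b ∷ [] else []) ++_)
              (cong₂ _++_ (sym (map-∘ movIndices))
                          (trans (map-concatMap vecMap decOps (range 1 m))
                                 (concatMap-cong (λ jj → map-if (decCondition jj)) (range 1 m)))) ⟩
    (if j ≡ᵇ 1 then cyc b ∷ [] else []) ++ MV P k j ++ DC P k j ∎))
    where
    open ≡-Reasoning
    map-if : ∀ c {o} → map vecMap (if c then o ∷ [] else []) ≡ (if c then vecMap o ∷ [] else [])
    map-if true  = refl
    map-if false = refl

  Member : Op → Set
  Member cycOp        = j ≡ 1
  Member (movOp jj)   = 1 ≤ jj × jj ≤ k ∸ 2 × jj * (2 + q) ≤ k ∸ 2 × (j + jj) % P ≡ 1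
  Member (decOp jj s) = 1 ≤ jj × jj ≤ m × (j + jj) % P ≢ 1 × (j + jj) % P ≢ 2 × s ≡ decIndex jj × s ≤ k ∸ 1

  ∈opsQ⇒Member : ∀ {o} → o ∈ opsQ → Member o
  ∈opsQ⇒Member o∈ with ∈-++⁻ cycOps o∈
  ... | inj₁ o∈cyc with t , here refl ← ∈-if⁻ {c = j ≡ᵇ 1} o∈cyc = ≡ᵇ⇒≡ j 1 t
  ... | inj₂ o∈ with ∈-++⁻ (map movOp movIndices) o∈
  ... | inj₁ o∈mov with jj , jj∈ , refl ← ∈-map⁻ movOp o∈mov
                   with jj∈range , t ← ∈-filter⁻ (T? ∘ movCondition) jj∈ =
    let (1≤jj , jj≤) = ∈-range⁻ 1 (k ∸ 2) jj∈range
        (t₁ , t₂)    = Equivalence.to T-∧ t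
    in 1≤jj , jj≤ , ≤ᵇ⇒≤ _ _ t₁ , ≡ᵇ⇒≡ _ 1 t₂
  ... | inj₂ o∈dec with jj , jj∈ , o∈decOps ← find (∈-concatMap⁻ decOps {xs = range 1 m} o∈dec)
                   with t , here refl ← ∈-if⁻ {c = decCondition jj} o∈decOps =
    let (1≤jj , jj≤m) = ∈-range⁻ 1 m jj∈
        (t₁ , t′)     = Equivalence.to T-∧ t
        (t₂ , t₃)     = Equivalence.to T-∧ t′
    in 1≤jj , jj≤m , T-not-≡ᵇ⇒≢ _ 1 t₁ , T-not-≡ᵇ⇒≢ _ 2 t₂ , refl , ≤ᵇ⇒≤ _ _ t₃

  Member⇒∈opsQ : ∀ {o} → Member o → o ∈ opsQ
  Member⇒∈opsQ {cycOp} refl = here refl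
  Member⇒∈opsQ {movOp jj} (1≤jj , jj≤ , le , residue) =
    ∈-++⁺ʳ cycOps (∈-++⁺ˡ (∈-map⁺ movOp (∈-filter⁺ (T? ∘ movCondition) (∈-range⁺ 1 (k ∸ 2) 1≤jj jj≤)
                                                  (Equivalence.from T-∧ (≤⇒≤ᵇ le , ≡⇒≡ᵇ _ 1 residue)))))
  Member⇒∈opsQ {decOp jj s} (1≤jj , jj≤m , ≢1 , ≢2 , refl , s≤) =
    ∈-++⁺ʳ cycOps (∈-++⁺ʳ (map movOp movIndices) (∈-concatMap⁺ decOps (lose (∈-range⁺ 1 m 1≤jj jj≤m)
      (∈-if⁺ {c = decCondition jj}
             (Equivalence.from T-∧ (≢⇒T-not-≡ᵇ _ 1 ≢1 , Equivalence.from T-∧ (≢⇒T-not-≡ᵇ _ 2 ≢2 , ≤⇒≤ᵇ s≤)))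
             (here refl)))))

  decIndex-residue : ∀ jj0 e → (j0 + suc jj0) % P ≡ suc e → decIndex (suc jj0) ≡ (2 + q) * jj0 + e
  decIndex-residue jj0 e residue =
    trans (cong (λ r → (2 + q) * jj0 + r ∸ 1) residue) (cong (_∸ 1) (+-suc ((2 + q) * jj0) e))

  Member⇒Valid : ∀ {o} → Member o → Valid o
  Member⇒Valid {cycOp}    _ = tt
  Member⇒Valid {movOp jj} (1≤jj , _ , le , _) = 1≤jj , ≤-cdiv jj (k ∸ 2) (suc q) le
  Member⇒Valid {decOp (suc jj0) s} (1≤jj , jj≤m , ≢1 , ≢2 , refl , _)
    with e , residue , _ ← dec-stage j0 jj0 j≤p ≢1 ≢2 =
    1≤jj , jj≤m , subst (1 ≤_) (sym (decIndex-residue jj0 (suc e) residue)) (≤-trans (s≤s z≤n) (m≤n+m (suc e) _))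

  D : ℕ
  D = DS P k

  stageIndices : List ℕ
  stageIndices = filterᵇ (_≤ᵇ D) (map (λ i → j + P * i) (range 0 D))

  S⊆Tst : ∀ {c} i {stage} → stage ≡ j + P * i → stage ≤ D → c ∈ S P k stage → c ∈ Tst P k j
  S⊆Tst i refl m≤D c∈ = ∈-concatMap⁺ (S P k) {xs = stageIndices} (lose m∈ c∈)
    where
    i≤D : i ≤ D
    i≤D = ≤-trans (m≤n*m i P) (≤-trans (m≤n+m (P * i) j) m≤D)
    m∈ : j + P * i ∈ stageIndices
    m∈ = ∈-filter⁺ (T? ∘ (_≤ᵇ D)) (∈-map⁺ (λ i → j + P * i) (∈-range⁺ 0 D z≤n i≤D)) (≤⇒≤ᵇ m≤D)

  comparators⊆Tst : ∀ {o c} → Member o → c ∈ comparators o → c ∈ Tst P k j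
  comparators⊆Tst {cycOp} refl c∈ =
    S⊆Tst 0 (cong suc (sym (*-zeroʳ P))) (≤-trans 1≤m (m≤n+m m (k ∸ 1))) (∈-++⁺ˡ c∈)
  comparators⊆Tst {movOp jj} {c} (1≤jj , jj≤k∸2 , le , residue) c∈
    with i , eq ← mov-stage j jj j≤p residue = S⊆Tst i eq stage≤D
      (∈-++⁺ʳ (if stage ≡ᵇ 1 then S₁ P k else []) (∈-++⁺ʳ (Sdec P k stage)
        (∈-concatMap⁺ _ {xs = range 1 (k ∸ 2)} (lose (∈-range⁺ 1 (k ∸ 2) 1≤jj jj≤k∸2)
          (∈-if⁺ (Equivalence.from T-∧ (≤⇒≤ᵇ le , ≡⇒≡ᵇ stage stage refl)) c∈)))))
    where
    stage = (3 + q) * jj + 1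
    split : ∀ jj q → (3 + q) * jj + 1 ≡ jj * (2 + q) + 1 + jj
    split = solve-∀
    stage≤D : stage ≤ D
    stage≤D = ≤-trans (≤-reflexive (split jj q))
                      (+-mono-≤ (subst (jj * (2 + q) + 1 ≤_) (trans (+-comm (k ∸ 2) 1) (sym (+-∸-assoc 1 2≤k)))
                                        (+-monoˡ-≤ 1 le))
                                (proj₂ (Member⇒Valid {movOp jj} (1≤jj , jj≤k∸2 , le , residue))))
  comparators⊆Tst {decOp (suc jj0) s} {c} (1≤jj , jj≤m , ≢1 , ≢2 , refl , s≤) c∈
    with e , residue , i , eq ← dec-stage j0 jj0 j≤p ≢1 ≢2 = S⊆Tst i eq stage≤D
      (∈-++⁺ʳ (if stage ≡ᵇ 1 then S₁ P k else []) (∈-++⁺ˡ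
        (∈-concatMap⁺ _ {xs = range 1 m} (lose (∈-range⁺ 1 m 1≤jj jj≤m) (∈-if⁺ condition c∈′)))))
    where
    x = (2 + q) * jj0
    stage = suc jj0 + (x + suc e)
    stage∸jj : stage ∸ suc jj0 ≡ x + suc e
    stage∸jj = m+n∸m≡n (suc jj0) (x + suc e)
    s≡ : decIndex (suc jj0) ≡ stage ∸ suc jj0
    s≡ = trans (decIndex-residue jj0 (suc e) residue) (sym stage∸jj)
    c∈′ : c ∈ comparators (decOp (suc jj0) (stage ∸ suc jj0))
    c∈′ = subst (λ s → c ∈ comparators (decOp (suc jj0) s)) s≡ c∈
    stage≤D : stage ≤ D
    stage≤D = subst (_≤ D) (cong (suc jj0 +_) (decIndex-residue jj0 (suc e) residue))
                    (≤-trans (+-mono-≤ jj≤m s≤) (≤-reflexive (+-comm m (k ∸ 1))))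
    1+e≤2+q : suc e ≤ 2 + q
    1+e≤2+q = s≤s⁻¹ (s≤s⁻¹ (subst (_< P) residue (m%n<n (j0 + suc jj0) P)))
    condition : T ((suc jj0 <ᵇ stage) ∧ (x <ᵇ stage ∸ suc jj0) ∧ (stage ∸ suc jj0 ≤ᵇ (2 + q) * suc jj0)
                   ∧ (stage ∸ suc jj0 ≤ᵇ k ∸ 1))
    condition = Equivalence.from T-∧
      ( <⇒<ᵇ (m<m+n (suc jj0) (≤-trans (s≤s z≤n) (m≤n+m (suc e) x)))
      , Equivalence.from T-∧
        ( <⇒<ᵇ (subst (x <_) (sym stage∸jj) (m<m+n x (s≤s z≤n)))
        , Equivalence.from T-∧
          ( ≤⇒≤ᵇ (subst (_≤ (2 + q) * suc jj0) (sym stage∸jj)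
                        (subst (x + suc e ≤_) (trans (+-comm x (2 + q)) (sym (*-suc (2 + q) jj0))) (+-monoʳ-≤ x 1+e≤2+q)))
          , ≤⇒≤ᵇ (subst (_≤ k ∸ 1) s≡ s≤))))

  mov-member : ∀ jj i → jj ∈ range 1 (k ∸ 2) →
               T ((jj * (2 + q) ≤ᵇ k ∸ 2) ∧ ((3 + q) * jj + 1 ≡ᵇ j + P * i)) → Member (movOp jj)
  mov-member jj i jj∈ t =
    let (1≤jj , jj≤) = ∈-range⁻ 1 (k ∸ 2) jj∈
        (t₁ , t₂)    = Equivalence.to T-∧ t
    in 1≤jj , jj≤ , ≤ᵇ⇒≤ _ _ t₁ , mov-residue j jj i (sym (≡ᵇ⇒≡ _ _ t₂))

  dec-member : ∀ jj i → jj ∈ range 1 m →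
               let stage = j + P * i ; s = stage ∸ jj in
               T ((jj <ᵇ stage) ∧ ((2 + q) * (jj ∸ 1) <ᵇ s) ∧ (s ≤ᵇ (2 + q) * jj) ∧ (s ≤ᵇ k ∸ 1)) →
               Member (decOp jj s)
  dec-member zero      i jj∈ t with () ← proj₁ (∈-range⁻ 1 m jj∈)
  dec-member (suc jj0) i jj∈ t = s≤s z≤n , proj₂ (∈-range⁻ 1 m jj∈) , ≢1 , ≢2 , s≡ , s≤k∸1
    where
    stage = j + P * i
    s = stage ∸ suc jj0
    x = (2 + q) * jj0
    bounds = Equivalence.to T-∧ t
    more   = Equivalence.to T-∧ (proj₂ bounds)
    most   = Equivalence.to T-∧ (proj₂ more)
    jj<stage : suc jj0 < stage
    jj<stage = <ᵇ⇒< (suc jj0) stage (proj₁ bounds)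
    x<s : x < s
    x<s = <ᵇ⇒< x s (proj₁ more)
    s≤ : s ≤ (2 + q) * suc jj0
    s≤ = ≤ᵇ⇒≤ s _ (proj₁ most)
    s≤k∸1 : s ≤ k ∸ 1
    s≤k∸1 = ≤ᵇ⇒≤ s (k ∸ 1) (proj₂ most)
    e = s ∸ x
    s≡x+e : s ≡ x + e
    s≡x+e = sym (m+[n∸m]≡n (<⇒≤ x<s))
    1≤e : 1 ≤ e
    1≤e = m+n≤o⇒m≤o∸n 1 x<s
    e≤2+q : e ≤ 2 + q
    e≤2+q = subst (e ≤_) (m+n∸n≡m (2 + q) x) (∸-monoˡ-≤ x (subst (s ≤_) (*-suc (2 + q) jj0) s≤))
    residues = dec-residue j0 jj0 i e (trans (sym (m+[n∸m]≡n (<⇒≤ jj<stage))) (cong (suc jj0 +_) s≡x+e)) 1≤e e≤2+q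
    ≢1 = proj₁ (proj₂ residues)
    ≢2 = proj₂ (proj₂ residues)
    s≡ : s ≡ decIndex (suc jj0)
    s≡ = trans s≡x+e (sym (decIndex-residue jj0 e (proj₁ residues)))

  Tst⊆comparators : ∀ {c} → c ∈ Tst P k j → ∃ λ o → Member o × c ∈ comparators o
  Tst⊆comparators c∈ with stage , stage∈ , c∈S ← find (∈-concatMap⁻ (S P k) {xs = stageIndices} c∈)
    with stage∈′ , _ ← ∈-filter⁻ (T? ∘ (_≤ᵇ D)) {xs = map (λ i → j + P * i) (range 0 D)} stage∈
    with i , _ , refl ← ∈-map⁻ (λ i → j + P * i) {xs = range 0 D} stage∈′
    with ∈-++⁻ (if j + P * i ≡ᵇ 1 then S₁ P k else []) c∈S
  ... | inj₁ c∈S₁ with t , c∈′ ← ∈-if⁻ {c = j + P * i ≡ᵇ 1} c∈S₁ =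
    cycOp , cong suc (m+n≡0⇒m≡0 j0 (suc-injective (≡ᵇ⇒≡ (j + P * i) 1 t))) , c∈′
  ... | inj₂ c∈S′ with ∈-++⁻ (Sdec P k (j + P * i)) c∈S′
  ... | inj₁ c∈dec with jj , jj∈ , c∈part ← find (∈-concatMap⁻ _ {xs = range 1 m} c∈dec)
                   with t , c∈′ ← ∈-if⁻ c∈part = decOp jj (j + P * i ∸ jj) , dec-member jj i jj∈ t , c∈′
  ... | inj₂ c∈mov with jj , jj∈ , c∈part ← find (∈-concatMap⁻ _ {xs = range 1 (k ∸ 2)} c∈mov)
                   with t , c∈′ ← ∈-if⁻ c∈part = movOp jj , mov-member jj i jj∈ t , c∈′

  private
    sum≢b+1 : ∀ {u u′} → u ≤ m → u′ ≤ m → u + u′ ≢ b + 1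
    sum≢b+1 {u} {u′} u≤m u′≤m =
      <⇒≢ (≤-<-trans (subst (u + u′ ≤_) (sym b≡m+m) (+-mono-≤ u≤m u′≤m)) (m<m+n b (s≤s z≤n)))

  Mirror : ℕ → ℕ → Set
  Mirror t u = t ≡ u ⊎ t + u ≡ b + 1

  mirror-unique : ∀ {t u u′} → u ≤ m → u′ ≤ m → Mirror t u → Mirror t u′ → u ≡ u′
  mirror-unique _   _    (inj₁ refl) (inj₁ refl) = refl
  mirror-unique u≤m u′≤m (inj₁ refl) (inj₂ e)    = contradiction e (sum≢b+1 u≤m u′≤m)
  mirror-unique u≤m u′≤m (inj₂ e)    (inj₁ refl) = contradiction e (sum≢b+1 u′≤m u≤m)
  mirror-unique _   _    (inj₂ e)    (inj₂ e′)   = +-cancelˡ-≡ _ _ _ (trans e (sym e′))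

  Key : Op → ℕ → Set
  Key cycOp        u = u ≡ 1
  Key (movOp jj)   u = u ≡ jj ⊎ u ≡ jj + 1
  Key (decOp jj _) u = u ≡ jj

  private
    twice+1 : ∀ x → x + 1 + x ≡ x + x + 1
    twice+1 = solve-∀

  column-key : ∀ {o f t} → Valid o → f ∈ families o → f hasColumn t → ∃ λ u → Mirror t u × u ≤ m × Key o u
  column-key {cycOp} _ (here refl) (inj₁ refl) = 1 , inj₂ refl , 1≤m , refl
  column-key {cycOp} _ (here refl) (inj₂ refl) = 1 , inj₁ refl , 1≤m , refl
  column-key {decOp jj s} (_ , jj≤m , _) (here refl) (inj₁ refl) = jj , inj₁ refl , jj≤m , refl
  column-key {decOp jj s} (_ , jj≤m , _) (here refl) (inj₂ refl) =
    jj , inj₂ (b∸j+1+j≡b+1 (≤-trans jj≤m m≤b)) , jj≤m , refl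
  column-key {movOp jj} (_ , jj≤m) (here refl) (inj₁ refl) = jj , inj₁ refl , jj≤m , inj₁ refl
  column-key {movOp jj} (_ , jj≤m) (here refl) (inj₂ refl) with m≤n⇒m<n∨m≡n jj≤m
  ... | inj₁ jj<m = jj + 1 , inj₁ refl , subst (_≤ m) (+-comm 1 jj) jj<m , inj₂ refl
  ... | inj₂ refl = jj , inj₂ (trans (twice+1 jj) (cong (_+ 1) (sym b≡m+m))) , jj≤m , inj₁ refl
  column-key {movOp jj} (_ , jj≤m) (there (here refl)) (inj₁ refl) with m≤n⇒m<n∨m≡n jj≤m
  ... | inj₁ jj<m = jj + 1 , inj₂ (trans (sym (+-assoc (b ∸ jj) jj 1)) (cong (_+ 1) (m∸n+n≡m (≤-trans jj≤m m≤b)))) ,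
                    subst (_≤ m) (+-comm 1 jj) jj<m , inj₂ refl
  ... | inj₂ refl = jj , inj₁ (trans (cong (_∸ jj) b≡m+m) (m+n∸n≡m jj jj)) , jj≤m , inj₁ refl
  column-key {movOp jj} (_ , jj≤m) (there (here refl)) (inj₂ refl) =
    jj , inj₂ (b∸j+1+j≡b+1 (≤-trans jj≤m m≤b)) , jj≤m , inj₁ refl

  private
    Key-mov-gap : ∀ {jj jj′ u} → jj + 4 ≤ jj′ → Key (movOp jj) u → ¬ Key (movOp jj′) u
    Key-mov-gap {jj} {jj′} gap key key′ =
      <⇒≱ (≤-<-trans (upper key) (<-≤-trans (+-monoʳ-< jj (s≤s (s≤s z≤n))) gap)) (lower key′)
      where
      upper : ∀ {u} → Key (movOp jj) u → u ≤ jj + 1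
      upper (inj₁ refl) = m≤m+n jj 1
      upper (inj₂ refl) = ≤-refl
      lower : ∀ {u} → Key (movOp jj′) u → jj′ ≤ u
      lower (inj₁ refl) = ≤-refl
      lower (inj₂ refl) = m≤m+n jj′ 1

    cyc⇒residue2 : j ≡ 1 → (j + 1) % P ≡ 2
    cyc⇒residue2 refl = 2%P≡2

    cyc-mov : ∀ {jj u} → Member cycOp → Member (movOp jj) → Key cycOp u → ¬ Key (movOp jj) u
    cyc-mov j≡1 (_ , _ , _ , residue) refl (inj₁ refl) = contradiction (trans (sym residue) (cyc⇒residue2 j≡1)) λ ()
    cyc-mov _   (1≤jj , _) refl (inj₂ 1≡jj+1) =
      contradiction (trans (+-comm 1 _) (sym 1≡jj+1)) (<⇒≢ (s≤s 1≤jj) ∘ sym)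

    cyc-dec : ∀ {jj s u} → Member cycOp → Member (decOp jj s) → Key cycOp u → ¬ Key (decOp jj s) u
    cyc-dec j≡1 (_ , _ , _ , ≢2 , _) refl refl = ≢2 (cyc⇒residue2 j≡1)

    mov-dec : ∀ {jj jj′ s u} → Member (movOp jj) → Member (decOp jj′ s) → Key (movOp jj) u → ¬ Key (decOp jj′ s) u
    mov-dec (_ , _ , _ , residue) (_ , _ , ≢1 , _) (inj₁ refl) refl = ≢1 residue
    mov-dec {jj} (_ , _ , _ , residue) (_ , _ , _ , ≢2 , _) (inj₂ refl) refl =
      ≢2 (subst (λ a → a % P ≡ 2) (sym (trans (sym (+-assoc j jj 1)) (+-comm (j + jj) 1)))
                (suc-residue (j + jj) residue (s≤s (s≤s (s≤s z≤n)))))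

  same-key : ∀ {o o′ u} → Member o → Member o′ → Key o u → Key o′ u → o ≡ o′
  same-key {cycOp}      {cycOp}       _  _  _   _    = refl
  same-key {cycOp}      {movOp _}     m  m′ key key′ = contradiction key′ (cyc-mov m m′ key)
  same-key {cycOp}      {decOp _ _}   m  m′ key key′ = contradiction key′ (cyc-dec m m′ key)
  same-key {movOp _}    {cycOp}       m  m′ key key′ = contradiction key (cyc-mov m′ m key′)
  same-key {decOp _ _}  {cycOp}       m  m′ key key′ = contradiction key (cyc-dec m′ m key′)
  same-key {movOp _}    {decOp _ _}   m  m′ key key′ = contradiction key′ (mov-dec m m′ key)
  same-key {decOp _ _}  {movOp _}     m  m′ key key′ = contradiction key (mov-dec m′ m key′)
  same-key {movOp jj}   {movOp jj′}   (_ , _ , _ , residue) (_ , _ , _ , residue′) key key′ with <-cmp jj jj′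
  ... | tri≈ _ refl _   = refl
  ... | tri< jj<jj′ _ _ = contradiction key′ (Key-mov-gap (mov-gap j jj jj′ residue residue′ jj<jj′) key)
  ... | tri> _ _ jj′<jj = contradiction key (Key-mov-gap (mov-gap j jj′ jj residue′ residue jj′<jj) key′)
  same-key {decOp jj s} {decOp jj′ s′} (_ , _ , _ , _ , refl , _) (_ , _ , _ , _ , refl , _) refl refl = refl

  familiesQ : List Family
  familiesQ = concatMap families opsQ

  comparatorsQ : List Comparator
  comparatorsQ = concatMap comparators opsQ

  opsQ-valid : ∀ {o} → o ∈ opsQ → Valid o
  opsQ-valid = Member⇒Valid ∘ ∈opsQ⇒Member

  decompositionQ : Decomposition familiesQ comparatorsQ
  decompositionQ = record
    { minCol-column = λ f∈ → let _ , o∈ , f∈o = owner f∈ in Decomposition.minCol-column (decomposition-of o∈) f∈o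
    ; maxCol-column = λ f∈ → let _ , o∈ , f∈o = owner f∈ in Decomposition.maxCol-column (decomposition-of o∈) f∈o
    ; minCol≢maxCol = λ f∈ → let _ , o∈ , f∈o = owner f∈ in Decomposition.minCol≢maxCol (decomposition-of o∈) f∈o
    ; disjoint     = disjoint
    ; ∈⇒comparator = ∈⇒comparator
    ; comparator∈  = comparator∈
    }
    where
    decomposition-of : ∀ {o} → o ∈ opsQ → Decomposition (families o) (comparators o)
    decomposition-of {o} o∈ = decomposition o (opsQ-valid o∈)
    owner : ∀ {f} → f ∈ familiesQ → ∃ λ o → o ∈ opsQ × f ∈ families o
    owner f∈ = find (∈-concatMap⁻ families {xs = opsQ} f∈)
    disjoint : ∀ {f f′ t} → f ∈ familiesQ → f′ ∈ familiesQ → f hasColumn t → f′ hasColumn t → f ≡ f′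
    disjoint f∈ f′∈ f-t f′-t
      with o , o∈ , f∈o ← owner f∈ | o′ , o′∈ , f′∈o′ ← owner f′∈
      with u , mirror , u≤m , key ← column-key (opsQ-valid o∈) f∈o f-t
         | u′ , mirror′ , u′≤m , key′ ← column-key (opsQ-valid o′∈) f′∈o′ f′-t
      with refl ← mirror-unique u≤m u′≤m mirror mirror′
      with refl ← same-key (∈opsQ⇒Member o∈) (∈opsQ⇒Member o′∈) key key′
      = Decomposition.disjoint (decomposition-of o∈) f∈o f′∈o′ f-t f′-t
    ∈⇒comparator : ∀ {c} → c ∈ comparatorsQ → ∃₂ λ f i → f ∈ familiesQ × i + offset f < n × c ≡ comparator f i
    ∈⇒comparator c∈ with o , o∈ , c∈o ← find (∈-concatMap⁻ comparators {xs = opsQ} c∈)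
      with f , i , f∈o , i+h<n , c≡ ← Decomposition.∈⇒comparator (decomposition-of o∈) c∈o
      = f , i , ∈-concatMap⁺ families {xs = opsQ} (lose o∈ f∈o) , i+h<n , c≡
    comparator∈ : ∀ {f i} → f ∈ familiesQ → i + offset f < n → comparator f i ∈ comparatorsQ
    comparator∈ f∈ i+h<n with _ , o∈ , f∈o ← owner f∈ =
      ∈-concatMap⁺ comparators {xs = opsQ} (lose o∈ (Decomposition.comparator∈ (decomposition-of o∈) f∈o i+h<n))

  runStage-Tst : ∀ x r → runStage comparatorsQ x r ≡ runStage (Tst P k j) x r
  runStage-Tst x r = runStage-cong comparatorsQ (Tst P k j) x r (coherent decompositionQ) Q⊆T T⊆Q
    where
    Q⊆T : ∀ {c} → c ∈ comparatorsQ → c ∈ Tst P k j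
    Q⊆T c∈ with o , o∈ , c∈o ← find (∈-concatMap⁻ comparators {xs = opsQ} c∈) =
      comparators⊆Tst (∈opsQ⇒Member o∈) c∈o
    T⊆Q : ∀ {c} → c ∈ Tst P k j → c ∈ comparatorsQ
    T⊆Q c∈ with o , member , c∈o ← Tst⊆comparators c∈ =
      ∈-concatMap⁺ comparators {xs = opsQ} (lose (Member⇒∈opsQ member) c∈o)

  colOnes-Tst : ∀ x t → colOnes P k (runStage comparatorsQ x) t ≡ colOnes P k (runStage (Tst P k j) x) t
  colOnes-Tst x t = colOnes-cong {runStage comparatorsQ x} {runStage (Tst P k j) x} t (λ l → runStage-Tst x (reg t l))


open import Data.Integer using (+_)

lemma3p12 : (p k j : ℕ) → 4 ≤ p → p ≤ k → 1 ≤ j → j ≤ p →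
    (x : ℕ → Bool) →
    (∀ t → 1 ≤ t → t ≤ bW p k → ColumnSorted p k x t) →
    ∀ t → 1 ≤ t → t ≤ bW p k →
      Qmap p k j (λ u → + colOnes p k x u) t
        ≡ + colOnes p k (runStage (Tst p k j) x) t
lemma3p12 .(4 + q) k .(suc j0) (s≤s (s≤s (s≤s (s≤s (z≤n {q}))))) 4+q≤k (s≤s (z≤n {j0})) j≤p x sorted t 1≤t t≤b =
  begin
    Qmap P k j ones t                               ≡⟨ cong-app (Qmap-opsQ ones) t ⟩
    foldl (λ v f → f v) ones (map vecMap opsQ) t    ≡⟨ ones-after-ops opsQ (All.tabulate opsQ-valid) bounded
                                                         (sorted⇒thresholds x (λ (1≤u , u≤b) → sorted _ 1≤u u≤b))
                                                         ones≗ (1≤t , t≤b) ⟩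
    + colOnes P k (runStage comparatorsQ x) t       ≡⟨ cong +_ (colOnes-Tst x t) ⟩
    + colOnes P k (runStage (Tst P k j) x) t        ∎
  where
  open Residues q using (P)
  open Stage q k j0 4+q≤k j≤p
  open ≡-Reasoning
  ones : Vecb
  ones u = + colOnes P k x u
  bounded : ∀ u → n ∸ colOnes P k x u ≤ n
  bounded u = m∸n≤m n (colOnes P k x u)
  ones≗ : ∀ u → ones u ≡ + (n ∸ (n ∸ colOnes P k x u))
  ones≗ u = cong +_ (sym (m∸[m∸n]≡n (colOnes≤n x u)))
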